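{- Let $p$ be an odd prime, let $k$ be an integer with $0\le k\le p-1$, and let $n>0$ be an odd integer. Consider $$f_{n,k}(x)=k\sum_{j\geq 0}\binom{n-1}{2j+1}(x^j-x^{j+1})+2\sum_{j\geq 0}\binom{n}{2j}x^j\in\mathbb{F}_p[x].$$ Then $f_{n,k}(x)$ is self-reciprocal if and only if one of the following holds: (i) $n=1$ (for any $k$); (ii) $k=0$ and $n=p^l$ for some positive integer $l$; (iii) $n=3$ and $k=3$, with $p>3$; (iv) $k=1$ and $n+1\neq 2lp$ for every positive integer $l$.
   Context: Binomial coefficients $\binom{a}{b}$ are $0$ when $b>a$; coefficients are reduced modulo $p$. A nonzero polynomial $f(x)$ of (actual) degree $d\ge 0$ is self-reciprocal if $x^d f(1/x)=f(x)$, i.e. writing $f(x)=\sum_{i=0}^d a_ix^i$ with $a_d\neq0$, $a_i=a_{d-i}$ for $0\le i\le d$; nonzero constants count as self-reciprocal. -}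

module Defs where

open import Data.Nat as ℕ using (ℕ; zero; suc; _<_; _∸_; _≤_)
open import Data.Nat.Combinatorics using (_C_)
open import Data.Nat.Primality using (Prime; prime⇒nonZero)
open import Data.Integer as ℤ using (ℤ; +_)
open import Data.Integer.DivMod using (_%ℕ_)
open import Data.Product using (∃; _×_)
open import Relation.Binary.PropositionalEquality using (_≡_; _≢_)

-- Binomial coefficient "n-1 choose 2j-1", which is 0 for j = 0
-- (the term x^{j+1} with index j-1 in the first sum).
prevTerm : ℕ → ℕ → ℕ
prevTerm n zero    = 0
prevTerm n (suc j) = (n ∸ 1) C (2 ℕ.* j ℕ.+ 1)

-- Integer coefficient of x^i in
--   k Σ_j C(n-1,2j+1)(x^j - x^{j+1}) + 2 Σ_j C(n,2j) x^j
-- namely  k C(n-1,2i+1) - k C(n-1,2i-1) + 2 C(n,2i).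
-- (n ≥ 1 in the theorem, so n ∸ 1 is n - 1.)
fCoeffℤ : ℕ → ℕ → ℕ → ℤ
fCoeffℤ n k i =
  (+ (k ℕ.* ((n ∸ 1) C (2 ℕ.* i ℕ.+ 1))) ℤ.- + (k ℕ.* prevTerm n i))
  ℤ.+ + (2 ℕ.* (n C (2 ℕ.* i)))

fCoeff : (p : ℕ) → Prime p → ℕ → ℕ → ℕ → ℕ
fCoeff p pp n k i = _%ℕ_ (fCoeffℤ n k i) p {{prime⇒nonZero pp}}

-- A polynomial given by its coefficient sequence a : ℕ → ℕ (residues mod p,
-- so equality of residues is equality in F_p) is self-reciprocal iff it is
-- nonzero of actual degree d (a_d ≠ 0, a_i = 0 for i > d) and a_i = a_{d-i}
-- for 0 ≤ i ≤ d.
SelfReciprocal : (ℕ → ℕ) → Set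
SelfReciprocal a =
  ∃ λ d → (a d ≢ 0)
        × (∀ i → d < i → a i ≡ 0)
        × (∀ i → i ≤ d → a i ≡ a (d ∸ i))

-- Write n = 2m + 1. By Pascal's rule the coefficient of x^i in f_{n,k} is
-- a_i = k C(n,2i+1) + (2 - k) C(n,2i); it vanishes for i > m, a_m = k + (2 - k) n, and
-- a_i - a_{m-i} = 2 (k - 1) (C(n,2i+1) - C(n,2i)).
-- If a_m ≢ 0 (mod p) the degree is m, so either k = 1 or C(n,2j+1) ≡ C(n,2j) for all j;
-- the latter makes all odd binomial coefficients of 2m vanish mod p, which Lucas-type
-- congruences allow only for m = 0.
-- If a_m ≡ 0 and p ∣ n, then k = 0, and since C(qp,jp) ≡ C(q,j) while C(qp,j) ≡ 0 for p ∤ j,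
-- f_{qp,0}(x) ≡ f_{q,0}(x^p); descending along the powers of p in n gives n = p^l.
-- If a_m ≡ 0 and p ∤ n, eliminating C(n,2) and C(n,3) against a_m ≡ 0 shows that the degree
-- is m - 1, that n ≡ 3 and k = 3. Symmetry about m - 1 is then a third-order recurrence for
-- the odd binomial coefficients of n - 3 ≡ 0 (mod p), which kills all of them unless n = 3.

module Submission where

open import Defs

open import Data.Nat as ℕ using (ℕ; zero; suc; NonZero; z≤n; s≤s; _<_; _≤_; _∸_; _^_; _%_)
import Data.Nat.Properties as ℕₚ
open import Data.Nat.Combinatorics
  using (_C_; nCk+nC[k+1]≡[n+1]C[k+1]; k>n⇒nCk≡0; nCk≡nC[n∸k]; nC1≡n; nCn≡1)
open import Data.Nat.Primality using (Prime; euclidsLemma; prime⇒nonZero; ¬prime[0]; ¬prime[1])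
open import Data.Product using (∃; _×_; _,_; proj₁)
open import Data.Sum using (_⊎_; inj₁; inj₂; [_,_]′)
open import Function.Bundles using (_⇔_; mk⇔; Equivalence)
open import Relation.Binary.Definitions using (tri<; tri≈; tri>)
open import Relation.Binary.PropositionalEquality
open import Relation.Nullary using (¬_; contradiction; Dec; yes; no)
import Relation.Nullary.Decidable as Dec

module BinomialIdentities where

  open import Data.Integer using (ℤ; +_; 0ℤ; 1ℤ; _+_; _-_; _*_)
  open import Data.Integer.Properties using (pos-+; +-comm)
  open import Data.Integer.Tactic.RingSolver using (solve-∀)
  import Data.Nat.Tactic.RingSolver as ℕ-Solver

  [k+1]*[n+1]C[k+1]≡[n+1]*nCk : ∀ n k → suc k ℕ.* (suc n C suc k) ≡ suc n ℕ.* (n C k)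
  [k+1]*[n+1]C[k+1]≡[n+1]*nCk zero    zero    = refl
  [k+1]*[n+1]C[k+1]≡[n+1]*nCk zero    (suc k) = begin
    suc (suc k) ℕ.* (1 C suc (suc k)) ≡⟨ cong (suc (suc k) ℕ.*_) (k>n⇒nCk≡0 {1} {suc (suc k)} (s≤s (s≤s z≤n))) ⟩
    suc (suc k) ℕ.* 0                 ≡⟨ ℕₚ.*-zeroʳ (suc (suc k)) ⟩
    0                                 ≡⟨ cong (1 ℕ.*_) (k>n⇒nCk≡0 {0} {suc k} (s≤s z≤n)) ⟨
    1 ℕ.* (0 C suc k)                 ∎
    where open ≡-Reasoning
  [k+1]*[n+1]C[k+1]≡[n+1]*nCk (suc n) zero    = begin
    1 ℕ.* (suc (suc n) C 1) ≡⟨ ℕₚ.*-identityˡ _ ⟩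
    suc (suc n) C 1         ≡⟨ nC1≡n (suc (suc n)) ⟩
    suc (suc n)             ≡⟨ ℕₚ.*-identityʳ (suc (suc n)) ⟨
    suc (suc n) ℕ.* 1       ∎
    where open ≡-Reasoning
  [k+1]*[n+1]C[k+1]≡[n+1]*nCk (suc n) (suc k) = begin
    suc (suc k) ℕ.* (suc (suc n) C suc (suc k))
      ≡⟨ cong (suc (suc k) ℕ.*_) (nCk+nC[k+1]≡[n+1]C[k+1] (suc n) (suc k)) ⟨
    suc (suc k) ℕ.* (x ℕ.+ y)
      ≡⟨ regroup k x y ⟩
    suc k ℕ.* x ℕ.+ x ℕ.+ suc (suc k) ℕ.* y
      ≡⟨ cong₂ (λ a b → a ℕ.+ x ℕ.+ b) ([k+1]*[n+1]C[k+1]≡[n+1]*nCk n k)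
                                       ([k+1]*[n+1]C[k+1]≡[n+1]*nCk n (suc k)) ⟩
    suc n ℕ.* (n C k) ℕ.+ x ℕ.+ suc n ℕ.* (n C suc k)
      ≡⟨ regroup′ n (n C k) (n C suc k) x ⟩
    suc n ℕ.* (n C k ℕ.+ n C suc k) ℕ.+ x
      ≡⟨ cong (λ a → suc n ℕ.* a ℕ.+ x) (nCk+nC[k+1]≡[n+1]C[k+1] n k) ⟩
    suc n ℕ.* x ℕ.+ x
      ≡⟨ ℕₚ.+-comm (suc n ℕ.* x) x ⟩
    suc (suc n) ℕ.* x ∎
    where
    open ≡-Reasoning
    x y : ℕ
    x = suc n C suc k
    y = suc n C suc (suc k)
    regroup : ∀ k x y → suc (suc k) ℕ.* (x ℕ.+ y) ≡ suc k ℕ.* x ℕ.+ x ℕ.+ suc (suc k) ℕ.* y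
    regroup = ℕ-Solver.solve-∀
    regroup′ : ∀ n u v x → suc n ℕ.* u ℕ.+ x ℕ.+ suc n ℕ.* v ≡ suc n ℕ.* (u ℕ.+ v) ℕ.+ x
    regroup′ = ℕ-Solver.solve-∀

  [i+j]Ci≡[i+j]Cj : ∀ i j → (i ℕ.+ j) C i ≡ (i ℕ.+ j) C j
  [i+j]Ci≡[i+j]Cj i j = trans (nCk≡nC[n∸k] (ℕₚ.m≤m+n i j)) (cong ((i ℕ.+ j) C_) (ℕₚ.m+n∸m≡n i j))

  infix 8 _Cℤ_
  _Cℤ_ : ℕ → ℕ → ℤ
  n Cℤ k = + (n C k)

  Cℤ-pascal : ∀ n k → suc n Cℤ suc k ≡ n Cℤ k + n Cℤ suc k
  Cℤ-pascal n k = trans (cong +_ (sym (nCk+nC[k+1]≡[n+1]C[k+1] n k))) (pos-+ (n C k) (n C suc k))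

  Cℤ-vanish : ∀ {n k} → n < k → n Cℤ k ≡ 0ℤ
  Cℤ-vanish n<k = cong +_ (k>n⇒nCk≡0 n<k)

  2*nC2≡n*[n-1] : ∀ n → + 2 * n Cℤ 2 ≡ + n * (+ n - 1ℤ)
  2*nC2≡n*[n-1] zero    = refl
  2*nC2≡n*[n-1] (suc n) = begin
    + 2 * suc n Cℤ 2               ≡⟨ cong (+ 2 *_) (Cℤ-pascal n 1) ⟩
    + 2 * (n Cℤ 1 + n Cℤ 2)        ≡⟨ cong (λ c → + 2 * (+ c + n Cℤ 2)) (nC1≡n n) ⟩
    + 2 * (+ n + n Cℤ 2)           ≡⟨ distrib (+ n) (n Cℤ 2) ⟩
    + 2 * + n + + 2 * n Cℤ 2       ≡⟨ cong (λ c → + 2 * + n + c) (2*nC2≡n*[n-1] n) ⟩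
    + 2 * + n + + n * (+ n - 1ℤ)   ≡⟨ step (+ n) ⟩
    (1ℤ + + n) * (1ℤ + + n - 1ℤ)   ≡⟨ cong (λ a → a * (a - 1ℤ)) (pos-+ 1 n) ⟨
    + suc n * (+ suc n - 1ℤ)       ∎
    where
    open ≡-Reasoning
    distrib : ∀ a c → + 2 * (a + c) ≡ + 2 * a + + 2 * c
    distrib = solve-∀
    step : ∀ a → + 2 * a + a * (a - 1ℤ) ≡ (1ℤ + a) * (1ℤ + a - 1ℤ)
    step = solve-∀

  6*nC3≡n*[n-1]*[n-2] : ∀ n → + 6 * n Cℤ 3 ≡ + n * (+ n - 1ℤ) * (+ n - + 2)
  6*nC3≡n*[n-1]*[n-2] zero    = refl
  6*nC3≡n*[n-1]*[n-2] (suc n) = begin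
    + 6 * suc n Cℤ 3                                          ≡⟨ cong (+ 6 *_) (Cℤ-pascal n 2) ⟩
    + 6 * (n Cℤ 2 + n Cℤ 3)                                   ≡⟨ distrib (n Cℤ 2) (n Cℤ 3) ⟩
    + 3 * (+ 2 * n Cℤ 2) + + 6 * n Cℤ 3
      ≡⟨ cong₂ (λ c d → + 3 * c + d) (2*nC2≡n*[n-1] n) (6*nC3≡n*[n-1]*[n-2] n) ⟩
    + 3 * (+ n * (+ n - 1ℤ)) + + n * (+ n - 1ℤ) * (+ n - + 2) ≡⟨ step (+ n) ⟩
    (1ℤ + + n) * (1ℤ + + n - 1ℤ) * (1ℤ + + n - + 2)
      ≡⟨ cong (λ a → a * (a - 1ℤ) * (a - + 2)) (pos-+ 1 n) ⟨
    + suc n * (+ suc n - 1ℤ) * (+ suc n - + 2)                ∎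
    where
    open ≡-Reasoning
    distrib : ∀ c d → + 6 * (c + d) ≡ + 3 * (+ 2 * c) + + 6 * d
    distrib = solve-∀
    step : ∀ a → + 3 * (a * (a - 1ℤ)) + a * (a - 1ℤ) * (a - + 2) ≡ (1ℤ + a) * (1ℤ + a - 1ℤ) * (1ℤ + a - + 2)
    step = solve-∀

  -- shiftedCℤ r M t is C(M, t − r), taken to be 0 when t < r.
  shiftedCℤ : ℕ → ℕ → ℕ → ℤ
  shiftedCℤ zero    M t       = M Cℤ t
  shiftedCℤ (suc r) M zero    = 0ℤ
  shiftedCℤ (suc r) M (suc t) = shiftedCℤ r M t

  shiftedCℤ-pascal : ∀ r M t → shiftedCℤ r (suc M) t ≡ shiftedCℤ r M t + shiftedCℤ (suc r) M t
  shiftedCℤ-pascal zero    M zero    = refl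
  shiftedCℤ-pascal zero    M (suc t) = trans (Cℤ-pascal M t) (+-comm (M Cℤ t) (M Cℤ suc t))
  shiftedCℤ-pascal (suc r) M zero    = refl
  shiftedCℤ-pascal (suc r) M (suc t) = shiftedCℤ-pascal r M t

  shiftedCℤ-below : ∀ {r t} M → t < r → shiftedCℤ r M t ≡ 0ℤ
  shiftedCℤ-below {suc r} {zero}  M _         = refl
  shiftedCℤ-below {suc r} {suc t} M (s≤s t<r) = shiftedCℤ-below M t<r

  shiftedCℤ-+ : ∀ r M u → shiftedCℤ r M (r ℕ.+ u) ≡ M Cℤ u
  shiftedCℤ-+ zero    M u = refl
  shiftedCℤ-+ (suc r) M u = shiftedCℤ-+ r M u

  [3+M]Ct-expansion : ∀ M t → (3 ℕ.+ M) Cℤ t ≡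
    shiftedCℤ 0 M t + + 3 * shiftedCℤ 1 M t + + 3 * shiftedCℤ 2 M t + shiftedCℤ 3 M t
  [3+M]Ct-expansion M t = begin
    shiftedCℤ 0 (3 ℕ.+ M) t
      ≡⟨ shiftedCℤ-pascal 0 (2 ℕ.+ M) t ⟩
    shiftedCℤ 0 (2 ℕ.+ M) t + shiftedCℤ 1 (2 ℕ.+ M) t
      ≡⟨ cong₂ _+_ (shiftedCℤ-pascal 0 (1 ℕ.+ M) t) (shiftedCℤ-pascal 1 (1 ℕ.+ M) t) ⟩
    (shiftedCℤ 0 (1 ℕ.+ M) t + shiftedCℤ 1 (1 ℕ.+ M) t) + (shiftedCℤ 1 (1 ℕ.+ M) t + shiftedCℤ 2 (1 ℕ.+ M) t)
      ≡⟨ cong₂ _+_ (cong₂ _+_ (pascal 0) (pascal 1)) (cong₂ _+_ (pascal 1) (pascal 2)) ⟩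
    ((s 0 + s 1) + (s 1 + s 2)) + ((s 1 + s 2) + (s 2 + s 3))
      ≡⟨ collect (s 0) (s 1) (s 2) (s 3) ⟩
    s 0 + + 3 * s 1 + + 3 * s 2 + s 3 ∎
    where
    open ≡-Reasoning
    s : ℕ → ℤ
    s r = shiftedCℤ r M t
    pascal : ∀ r → shiftedCℤ r (suc M) t ≡ s r + s (suc r)
    pascal r = shiftedCℤ-pascal r M t
    collect : ∀ a b c d → ((a + b) + (b + c)) + ((b + c) + (c + d)) ≡ a + + 3 * b + + 3 * c + d
    collect = solve-∀

open BinomialIdentities

module Congruence where

  open import Data.Integer using (ℤ; +_; 0ℤ; _+_; _-_; _*_; -_; ∣_∣; _%ℕ_; _/ℕ_)
  open import Data.Integer.Properties
    using (+-inverseʳ; +-identityʳ; m-n≡m⊖n; ∣m⊝n∣≤m⊔n; ∣i∣≡0⇒i≡0; i-j≡0⇒i≡j; +-injective; abs-*)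
  open import Data.Integer.DivMod using (a≡a%ℕn+[a/ℕn]*n; n%ℕd<d)
  open import Data.Nat.DivMod using (m*n%n≡0)
  import Data.Integer.Divisibility.Signed as ℤ∣
  open import Data.Integer.Tactic.RingSolver using (solve-∀)
  open import Data.Nat.Divisibility using (_∣_; >⇒∤)
  open import Relation.Binary.Bundles using (Setoid)

  infix 4 _≡_mod_
  record _≡_mod_ (x y : ℤ) (p : ℕ) : Set where
    constructor mk-mod
    field divides-difference : + p ℤ∣.∣ x - y

  open _≡_mod_ public

  module _ {p : ℕ} where

    mod-reflexive : ∀ {x y} → x ≡ y → x ≡ y mod p
    mod-reflexive {x} refl = mk-mod (ℤ∣.divides 0ℤ (+-inverseʳ x))

    mod-refl : ∀ {x} → x ≡ x mod p
    mod-refl = mod-reflexive refl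

    mod-sym : ∀ {x y} → x ≡ y mod p → y ≡ x mod p
    mod-sym {x} {y} (mk-mod d) = mk-mod (subst (+ p ℤ∣.∣_) (negate x y) (ℤ∣.∣m⇒∣-m d))
      where
      negate : ∀ x y → - (x - y) ≡ y - x
      negate = solve-∀

    mod-trans : ∀ {x y z} → x ≡ y mod p → y ≡ z mod p → x ≡ z mod p
    mod-trans {x} {y} {z} (mk-mod d) (mk-mod e) = mk-mod (subst (+ p ℤ∣.∣_) (telescope x y z) (ℤ∣.∣m∣n⇒∣m+n d e))
      where
      telescope : ∀ x y z → (x - y) + (y - z) ≡ x - z
      telescope = solve-∀

    +-cong-mod : ∀ {x x′ y y′} → x ≡ x′ mod p → y ≡ y′ mod p → x + y ≡ x′ + y′ mod p
    +-cong-mod {x} {x′} {y} {y′} (mk-mod d) (mk-mod e) =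
      mk-mod (subst (+ p ℤ∣.∣_) (regroup x x′ y y′) (ℤ∣.∣m∣n⇒∣m+n d e))
      where
      regroup : ∀ x x′ y y′ → (x - x′) + (y - y′) ≡ (x + y) - (x′ + y′)
      regroup = solve-∀

    *-congˡ-mod : ∀ c {x y} → x ≡ y mod p → c * x ≡ c * y mod p
    *-congˡ-mod c {x} {y} (mk-mod d) = mk-mod (subst (+ p ℤ∣.∣_) (distrib c x y) (ℤ∣.∣n⇒∣m*n c d))
      where
      distrib : ∀ c x y → c * (x - y) ≡ c * x - c * y
      distrib = solve-∀

    +-cancelˡ-mod : ∀ x {y z} → x + y ≡ x + z mod p → y ≡ z mod p
    +-cancelˡ-mod x {y} {z} (mk-mod d) = mk-mod (subst (+ p ℤ∣.∣_) (cancel x y z) d)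
      where
      cancel : ∀ x y z → (x + y) - (x + z) ≡ y - z
      cancel = solve-∀

    ≡0-mod⇒∣ᶻ : ∀ {x} → x ≡ 0ℤ mod p → + p ℤ∣.∣ x
    ≡0-mod⇒∣ᶻ {x} (mk-mod d) = subst (+ p ℤ∣.∣_) (+-identityʳ x) d

    ∣ᶻ⇒≡0-mod : ∀ {x} → + p ℤ∣.∣ x → x ≡ 0ℤ mod p
    ∣ᶻ⇒≡0-mod {x} d = mk-mod (subst (+ p ℤ∣.∣_) (sym (+-identityʳ x)) d)

    ∣⇒≡0-mod : ∀ {n} → p ∣ n → + n ≡ 0ℤ mod p
    ∣⇒≡0-mod p∣n = ∣ᶻ⇒≡0-mod (ℤ∣.∣ᵤ⇒∣ p∣n)

    ≡0-mod⇒∣ : ∀ {n} → + n ≡ 0ℤ mod p → p ∣ n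
    ≡0-mod⇒∣ n≡0 = ℤ∣.∣⇒∣ᵤ (≡0-mod⇒∣ᶻ n≡0)

    i≡j⇒i-j≡0-mod : ∀ {x y} → x ≡ y mod p → x - y ≡ 0ℤ mod p
    i≡j⇒i-j≡0-mod x≡y = ∣ᶻ⇒≡0-mod (divides-difference x≡y)

    i-j≡0⇒i≡j-mod : ∀ {x y} → x - y ≡ 0ℤ mod p → x ≡ y mod p
    i-j≡0⇒i≡j-mod x-y≡0 = mk-mod (≡0-mod⇒∣ᶻ x-y≡0)

    +-≡0-mod : ∀ {x y} → x ≡ 0ℤ mod p → y ≡ 0ℤ mod p → x + y ≡ 0ℤ mod p
    +-≡0-mod x≡0 y≡0 = ∣ᶻ⇒≡0-mod (ℤ∣.∣m∣n⇒∣m+n (≡0-mod⇒∣ᶻ x≡0) (≡0-mod⇒∣ᶻ y≡0))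

    *-≡0-mod : ∀ {x} a → x ≡ 0ℤ mod p → a * x ≡ 0ℤ mod p
    *-≡0-mod a x≡0 = ∣ᶻ⇒≡0-mod (ℤ∣.∣n⇒∣m*n a (≡0-mod⇒∣ᶻ x≡0))

    ≡0-by-combination : ∀ {t x y} a b → t ≡ a * x + b * y → x ≡ 0ℤ mod p → y ≡ 0ℤ mod p → t ≡ 0ℤ mod p
    ≡0-by-combination a b t≡ax+by x≡0 y≡0 =
      subst (_≡ 0ℤ mod p) (sym t≡ax+by) (+-≡0-mod (*-≡0-mod a x≡0) (*-≡0-mod b y≡0))

    ≡0-by-recurrence : (x : ℕ → ℤ) → x 0 ≡ 0ℤ mod p → x 1 ≡ 0ℤ mod p → x 2 ≡ 0ℤ mod p →
      (∀ i → x (3 ℕ.+ i) - + 3 * x (2 ℕ.+ i) + + 3 * x (1 ℕ.+ i) - x i ≡ 0ℤ mod p) →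
      ∀ i → x i ≡ 0ℤ mod p
    ≡0-by-recurrence x x₀≡0 x₁≡0 x₂≡0 recurrence i = proj₁ (three-from i)
      where
      Three : ℕ → Set
      Three i = x i ≡ 0ℤ mod p × x (1 ℕ.+ i) ≡ 0ℤ mod p × x (2 ℕ.+ i) ≡ 0ℤ mod p
      solve-for-last : ∀ a b c d → d ≡ (d - + 3 * c + + 3 * b - a) + (+ 3 * c + (- + 3 * b + a))
      solve-for-last = solve-∀
      three-from : ∀ i → Three i
      three-from zero    = x₀≡0 , x₁≡0 , x₂≡0
      three-from (suc i) with three-from i
      ... | a≡0 , b≡0 , c≡0 = b≡0 , c≡0 ,
        subst (_≡ 0ℤ mod p) (sym (solve-for-last (x i) (x (1 ℕ.+ i)) (x (2 ℕ.+ i)) (x (3 ℕ.+ i))))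
          (+-≡0-mod (recurrence i) (+-≡0-mod (*-≡0-mod (+ 3) c≡0) (+-≡0-mod (*-≡0-mod (- + 3) b≡0) a≡0)))

    ≡-mod⇒≡ : ∀ {a b} → a < p → b < p → + a ≡ + b mod p → a ≡ b
    ≡-mod⇒≡ {a} {b} a<p b<p (mk-mod d) =
      +-injective (i-j≡0⇒i≡j (+ a) (+ b) (∣i∣≡0⇒i≡0 (divisor-of-smaller-is-0 ∣a-b∣<p (ℤ∣.∣⇒∣ᵤ d))))
      where
      ∣a-b∣<p : ∣ + a - + b ∣ < p
      ∣a-b∣<p = ℕₚ.≤-<-trans (subst (ℕ._≤ a ℕ.⊔ b) (cong ∣_∣ (sym (m-n≡m⊖n a b))) (∣m⊝n∣≤m⊔n a b))
                             (ℕₚ.⊔-lub a<p b<p)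
      divisor-of-smaller-is-0 : ∀ {m} → m < p → p ∣ m → m ≡ 0
      divisor-of-smaller-is-0 {zero}  _   _   = refl
      divisor-of-smaller-is-0 {suc m} m<p p∣m = contradiction p∣m (>⇒∤ m<p)

  mod-setoid : ℕ → Setoid _ _
  mod-setoid p = record
    { Carrier       = ℤ
    ; _≈_           = λ x y → x ≡ y mod p
    ; isEquivalence = record { refl = mod-refl ; sym = mod-sym ; trans = mod-trans }
    }

  ≡0-mod? : ∀ p x → Dec (x ≡ 0ℤ mod p)
  ≡0-mod? p x = Dec.map′ ∣ᶻ⇒≡0-mod ≡0-mod⇒∣ᶻ (+ p ℤ∣.∣? x)

  module _ {p : ℕ} .{{_ : NonZero p}} where

    x≡x%ℕp : ∀ x → x ≡ + (x %ℕ p) mod p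
    x≡x%ℕp x = mk-mod (ℤ∣.divides (x /ℕ p) (begin
      x - + (x %ℕ p)                         ≡⟨ cong (_- + (x %ℕ p)) (a≡a%ℕn+[a/ℕn]*n x p) ⟩
      + (x %ℕ p) + x /ℕ p * + p - + (x %ℕ p) ≡⟨ cancel (+ (x %ℕ p)) (x /ℕ p) (+ p) ⟩
      x /ℕ p * + p                           ∎))
      where
      open ≡-Reasoning
      cancel : ∀ r q d → r + q * d - r ≡ q * d
      cancel = solve-∀

    %ℕ-≡⇔≡-mod : ∀ x y → (x %ℕ p ≡ y %ℕ p) ⇔ (x ≡ y mod p)
    %ℕ-≡⇔≡-mod x y = mk⇔
      (λ eq → mod-trans (x≡x%ℕp x) (mod-trans (mod-reflexive (cong +_ eq)) (mod-sym (x≡x%ℕp y))))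
      (λ x≡y → ≡-mod⇒≡ (n%ℕd<d x p) (n%ℕd<d y p)
                 (mod-trans (mod-sym (x≡x%ℕp x)) (mod-trans x≡y (x≡x%ℕp y))))

    %ℕ≡0⇔≡0-mod : ∀ x → (x %ℕ p ≡ 0) ⇔ (x ≡ 0ℤ mod p)
    %ℕ≡0⇔≡0-mod x = subst (λ r → (x %ℕ p ≡ r) ⇔ (x ≡ 0ℤ mod p)) (m*n%n≡0 0 p) (%ℕ-≡⇔≡-mod x 0ℤ)

  module _ {p : ℕ} (p-prime : Prime p) where

    ≡0-mod-product : ∀ {x y} → x * y ≡ 0ℤ mod p → x ≡ 0ℤ mod p ⊎ y ≡ 0ℤ mod p
    ≡0-mod-product {x} {y} xy≡0
      with euclidsLemma ∣ x ∣ ∣ y ∣ p-prime (subst (p ∣_) (abs-* x y) (ℤ∣.∣⇒∣ᵤ (≡0-mod⇒∣ᶻ xy≡0)))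
    ... | inj₁ p∣x = inj₁ (∣ᶻ⇒≡0-mod (ℤ∣.∣ᵤ⇒∣ p∣x))
    ... | inj₂ p∣y = inj₂ (∣ᶻ⇒≡0-mod (ℤ∣.∣ᵤ⇒∣ p∣y))

    ≢0-mod-product : ∀ {x y} → ¬ x ≡ 0ℤ mod p → ¬ y ≡ 0ℤ mod p → ¬ x * y ≡ 0ℤ mod p
    ≢0-mod-product x≢0 y≢0 xy≡0 = [ x≢0 , y≢0 ]′ (≡0-mod-product xy≡0)

    ≡0-mod-cancelˡ : ∀ {x y} → ¬ x ≡ 0ℤ mod p → x * y ≡ 0ℤ mod p → y ≡ 0ℤ mod p
    ≡0-mod-cancelˡ x≢0 xy≡0 = [ (λ x≡0 → contradiction x≡0 x≢0) , (λ y≡0 → y≡0) ]′ (≡0-mod-product xy≡0)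

open Congruence

module LucasCongruences {p : ℕ} (p-prime : Prime p) where

  open import Data.Integer using (ℤ; +_; 0ℤ; 1ℤ; _+_)
  open import Data.Integer.Properties using (+-comm)
  open import Data.Integer.Tactic.RingSolver using (solve-∀)
  open import Data.Nat.Divisibility using (_∣_; _∣?_; divides; >⇒∤; m∣m*n; ∣m∸n∣n⇒∣m; ∣-refl)

  instance
    p≢0 : NonZero p
    p≢0 = prime⇒nonZero p-prime

  0<p : 0 < p
  0<p = ℕ.>-nonZero⁻¹ p

  p∣pCj : ∀ {j} → 0 < j → j < p → p Cℤ j ≡ 0ℤ mod p
  p∣pCj {suc j} _ j<p =
    [ (λ p∣j+1 → contradiction p∣j+1 (>⇒∤ j<p)) , ∣⇒≡0-mod ]′
      (euclidsLemma (suc j) (p C suc j) p-prime p∣[j+1]*pC[j+1])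
    where
    p∣[j+1]*pC[j+1] : p ∣ suc j ℕ.* (p C suc j)
    p∣[j+1]*pC[j+1] = subst (λ n → n ∣ suc j ℕ.* (n C suc j)) (ℕₚ.suc-pred p)
      (subst (suc (ℕ.pred p) ∣_) (sym ([k+1]*[n+1]C[k+1]≡[n+1]*nCk (ℕ.pred p) j)) (m∣m*n _))

  pCt≡0Ct+0C[t-p] : ∀ t → p Cℤ t ≡ 0 Cℤ t + shiftedCℤ p 0 t mod p
  pCt≡0Ct+0C[t-p] t =
    [ below t , (λ p≤t → subst P (ℕₚ.m+[n∸m]≡n p≤t) (above (t ∸ p))) ]′ (ℕₚ.<-≤-connex t p)
    where
    P : ℕ → Set
    P t = p Cℤ t ≡ 0 Cℤ t + shiftedCℤ p 0 t mod p
    below : ∀ t → t < p → P t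
    below zero    _   = mod-reflexive (cong (_+_ 1ℤ) (sym (shiftedCℤ-below 0 0<p)))
    below (suc t) t<p = mod-trans (p∣pCj (s≤s z≤n) t<p)
      (mod-reflexive (sym (cong₂ _+_ (Cℤ-vanish {0} {suc t} (s≤s z≤n)) (shiftedCℤ-below 0 t<p))))
    above : ∀ u → P (p ℕ.+ u)
    above zero    = mod-reflexive (begin
      p Cℤ (p ℕ.+ 0)                                ≡⟨ cong (p Cℤ_) (ℕₚ.+-identityʳ p) ⟩
      p Cℤ p                                        ≡⟨ cong +_ (nCn≡1 p) ⟩
      1ℤ                                            ≡⟨ cong₂ _+_ (Cℤ-vanish (ℕₚ.≤-trans 0<p (ℕₚ.m≤m+n p 0)))
                                                                 (shiftedCℤ-+ p 0 0) ⟨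
      0 Cℤ (p ℕ.+ 0) + shiftedCℤ p 0 (p ℕ.+ 0)      ∎)
      where open ≡-Reasoning
    above (suc u) = mod-reflexive (begin
      p Cℤ (p ℕ.+ suc u)                            ≡⟨ Cℤ-vanish (ℕₚ.m<m+n p (s≤s z≤n)) ⟩
      0ℤ                                            ≡⟨ cong₂ _+_ (Cℤ-vanish (ℕₚ.<-≤-trans 0<p (ℕₚ.m≤m+n p (suc u))))
                                                                 (trans (shiftedCℤ-+ p 0 (suc u)) (Cℤ-vanish {0} {suc u} (s≤s z≤n))) ⟨
      0 Cℤ (p ℕ.+ suc u) + shiftedCℤ p 0 (p ℕ.+ suc u) ∎)
      where open ≡-Reasoning

  -- The coefficientwise form of (1 + x)^(a+p) ≡ (1 + x)^a (1 + x^p).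
  [a+p]Ct≡aCt+aC[t-p] : ∀ a t → (a ℕ.+ p) Cℤ t ≡ a Cℤ t + shiftedCℤ p a t mod p
  [a+p]Ct≡aCt+aC[t-p] zero    t       = pCt≡0Ct+0C[t-p] t
  [a+p]Ct≡aCt+aC[t-p] (suc a) zero    = mod-reflexive (cong (_+_ 1ℤ) (sym (shiftedCℤ-below (suc a) 0<p)))
  [a+p]Ct≡aCt+aC[t-p] (suc a) (suc t) = begin
    suc (a ℕ.+ p) Cℤ suc t                                    ≡⟨ Cℤ-pascal (a ℕ.+ p) t ⟩
    (a ℕ.+ p) Cℤ t + (a ℕ.+ p) Cℤ suc t                       ≈⟨ +-cong-mod ([a+p]Ct≡aCt+aC[t-p] a t)
                                                                             ([a+p]Ct≡aCt+aC[t-p] a (suc t)) ⟩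
    (a Cℤ t + s t) + (a Cℤ suc t + s (suc t))                 ≡⟨ regroup (a Cℤ t) (s t) (a Cℤ suc t) (s (suc t)) ⟩
    (a Cℤ t + a Cℤ suc t) + (s (suc t) + s t)                 ≡⟨ cong₂ _+_ (Cℤ-pascal a t) (shiftedCℤ-pascal p a (suc t)) ⟨
    suc a Cℤ suc t + shiftedCℤ p (suc a) (suc t)              ∎
    where
    open import Relation.Binary.Reasoning.Setoid (mod-setoid p)
    s : ℕ → ℤ
    s = shiftedCℤ p a
    regroup : ∀ w x y z → (w + x) + (y + z) ≡ (w + y) + (z + x)
    regroup = solve-∀

  [ap]C[jp]≡aCj : ∀ a j → (a ℕ.* p) Cℤ (j ℕ.* p) ≡ a Cℤ j mod p
  [ap]C[jp]≡aCj zero    zero    = mod-refl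
  [ap]C[jp]≡aCj zero    (suc j) = mod-reflexive
    (trans (Cℤ-vanish (ℕₚ.<-≤-trans 0<p (ℕₚ.m≤m+n p (j ℕ.* p)))) (sym (Cℤ-vanish {0} {suc j} (s≤s z≤n))))
  [ap]C[jp]≡aCj (suc a) zero    = mod-refl
  [ap]C[jp]≡aCj (suc a) (suc j) = begin
    (p ℕ.+ a ℕ.* p) Cℤ (p ℕ.+ j ℕ.* p)                          ≡⟨ cong (_Cℤ (p ℕ.+ j ℕ.* p)) (ℕₚ.+-comm p (a ℕ.* p)) ⟩
    (a ℕ.* p ℕ.+ p) Cℤ (p ℕ.+ j ℕ.* p)                          ≈⟨ [a+p]Ct≡aCt+aC[t-p] (a ℕ.* p) (p ℕ.+ j ℕ.* p) ⟩
    (a ℕ.* p) Cℤ (suc j ℕ.* p) + shiftedCℤ p (a ℕ.* p) (p ℕ.+ j ℕ.* p)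
      ≡⟨ cong (_+_ ((a ℕ.* p) Cℤ (suc j ℕ.* p))) (shiftedCℤ-+ p (a ℕ.* p) (j ℕ.* p)) ⟩
    (a ℕ.* p) Cℤ (suc j ℕ.* p) + (a ℕ.* p) Cℤ (j ℕ.* p)        ≈⟨ +-cong-mod ([ap]C[jp]≡aCj a (suc j)) ([ap]C[jp]≡aCj a j) ⟩
    a Cℤ suc j + a Cℤ j                                         ≡⟨ +-comm (a Cℤ suc j) (a Cℤ j) ⟩
    a Cℤ j + a Cℤ suc j                                         ≡⟨ Cℤ-pascal a j ⟨
    suc a Cℤ suc j                                              ∎
    where open import Relation.Binary.Reasoning.Setoid (mod-setoid p)

  p∤t⇒[ap]Ct≡0 : ∀ a {t} → ¬ p ∣ t → (a ℕ.* p) Cℤ t ≡ 0ℤ mod p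
  p∤t⇒[ap]Ct≡0 zero    {zero}  p∤0 = contradiction (divides 0 refl) p∤0
  p∤t⇒[ap]Ct≡0 zero    {suc t} _   = mod-reflexive (Cℤ-vanish {0} {suc t} (s≤s z≤n))
  p∤t⇒[ap]Ct≡0 (suc a) {t}     p∤t = begin
    (p ℕ.+ a ℕ.* p) Cℤ t                       ≡⟨ cong (_Cℤ t) (ℕₚ.+-comm p (a ℕ.* p)) ⟩
    (a ℕ.* p ℕ.+ p) Cℤ t                       ≈⟨ [a+p]Ct≡aCt+aC[t-p] (a ℕ.* p) t ⟩
    (a ℕ.* p) Cℤ t + shiftedCℤ p (a ℕ.* p) t   ≈⟨ +-cong-mod (p∤t⇒[ap]Ct≡0 a p∤t) shifted≡0 ⟩
    0ℤ                                         ∎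
    where
    open import Relation.Binary.Reasoning.Setoid (mod-setoid p)
    shifted≡0 : shiftedCℤ p (a ℕ.* p) t ≡ 0ℤ mod p
    shifted≡0 with ℕₚ.<-≤-connex t p
    ... | inj₁ t<p = mod-reflexive (shiftedCℤ-below (a ℕ.* p) t<p)
    ... | inj₂ p≤t = subst (λ t → shiftedCℤ p (a ℕ.* p) t ≡ 0ℤ mod p) (ℕₚ.m+[n∸m]≡n p≤t)
      (mod-trans (mod-reflexive (shiftedCℤ-+ p (a ℕ.* p) (t ∸ p)))
                 (p∤t⇒[ap]Ct≡0 a (λ p∣t-p → p∤t (∣m∸n∣n⇒∣m p p≤t p∣t-p ∣-refl))))

  [p^l]Cj≡0 : ∀ l {j} → 0 < j → j ≢ p ^ l → (p ^ l) Cℤ j ≡ 0ℤ mod p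
  [p^l]Cj≡0 zero    {suc zero}    _   j≢1 = contradiction refl j≢1
  [p^l]Cj≡0 zero    {suc (suc j)} _   _   = mod-reflexive (Cℤ-vanish {1} {suc (suc j)} (s≤s (s≤s z≤n)))
  [p^l]Cj≡0 (suc l) {j}           0<j j≢p^[l+1] =
    subst (λ n → n Cℤ j ≡ 0ℤ mod p) (ℕₚ.*-comm (p ^ l) p) (multiple-of-p (p ∣? j))
    where
    multiple-of-p : Dec (p ∣ j) → (p ^ l ℕ.* p) Cℤ j ≡ 0ℤ mod p
    multiple-of-p (no p∤j) = p∤t⇒[ap]Ct≡0 (p ^ l) p∤j
    multiple-of-p (yes (divides i refl)) =
      mod-trans ([ap]C[jp]≡aCj (p ^ l) i) ([p^l]Cj≡0 l 0<i (λ i≡p^l → j≢p^[l+1] (i*p≡p^[l+1] i≡p^l)))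
      where
      0<i : 0 < i
      0<i = ℕₚ.n≢0⇒n>0 (λ { refl → ℕₚ.<-irrefl refl 0<j })
      i*p≡p^[l+1] : i ≡ p ^ l → i ℕ.* p ≡ p ^ suc l
      i*p≡p^[l+1] refl = ℕₚ.*-comm (p ^ l) p

odd-prime⇒2<p : ∀ {p} → Prime p → p % 2 ≡ 1 → 2 < p
odd-prime⇒2<p {0}               0-prime _  = contradiction 0-prime ¬prime[0]
odd-prime⇒2<p {1}               1-prime _  = contradiction 1-prime ¬prime[1]
odd-prime⇒2<p {suc (suc (suc _))} _     _  = s≤s (s≤s (s≤s z≤n))

module OddPrimeBinomials {p : ℕ} (p-prime : Prime p) (p-odd : p % 2 ≡ 1) where

  open import Data.Integer using (ℤ; +_; 0ℤ; 1ℤ; _+_)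
  open import Data.Integer.Properties using (+-comm; pos-*)
  open import Data.Nat.Divisibility using (_∣_; _∣?_; divides; ∣⇒≤)
  open import Data.Nat.DivMod using (_/_; m≡m%n+[m/n]*n)
  open import Data.Nat.Induction using (<-rec)
  import Data.Nat.Tactic.RingSolver as ℕ-Solver
  open LucasCongruences p-prime

  half : ℕ
  half = p / 2

  p≡1+2*half : p ≡ suc (2 ℕ.* half)
  p≡1+2*half = trans (m≡m%n+[m/n]*n p 2) (cong₂ ℕ._+_ p-odd (ℕₚ.*-comm half 2))

  2≢0-mod : ¬ + 2 ≡ 0ℤ mod p
  2≢0-mod 2≡0 = ℕₚ.<⇒≱ (odd-prime⇒2<p p-prime p-odd) (∣⇒≤ (≡0-mod⇒∣ 2≡0))

  1<p : 1 < p
  1<p = ℕₚ.<-trans (ℕₚ.n<1+n 1) (odd-prime⇒2<p p-prime p-odd)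

  p∣2j⇒p∣j : ∀ {j} → p ∣ 2 ℕ.* j → p ∣ j
  p∣2j⇒p∣j {j} p∣2j =
    [ (λ p∣2 → contradiction (∣⇒≡0-mod p∣2) 2≢0-mod) , (λ p∣j → p∣j) ]′ (euclidsLemma 2 j p-prime p∣2j)

  [1+2j]*p≡1+2[jp+half] : ∀ j → suc (2 ℕ.* j) ℕ.* p ≡ suc (2 ℕ.* (j ℕ.* p ℕ.+ half))
  [1+2j]*p≡1+2[jp+half] j = begin
    suc (2 ℕ.* j) ℕ.* p                     ≡⟨ cong (suc (2 ℕ.* j) ℕ.*_) p≡1+2*half ⟩
    suc (2 ℕ.* j) ℕ.* suc (2 ℕ.* half)      ≡⟨ expand j half ⟩
    suc (2 ℕ.* (j ℕ.* suc (2 ℕ.* half) ℕ.+ half)) ≡⟨ cong (λ q → suc (2 ℕ.* (j ℕ.* q ℕ.+ half))) p≡1+2*half ⟨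
    suc (2 ℕ.* (j ℕ.* p ℕ.+ half))          ∎
    where
    open ≡-Reasoning
    expand : ∀ j h → suc (2 ℕ.* j) ℕ.* suc (2 ℕ.* h) ≡ suc (2 ℕ.* (j ℕ.* suc (2 ℕ.* h) ℕ.+ h))
    expand = ℕ-Solver.solve-∀

  -- If p ∤ h then j = 0 works, as C(2h,1) = 2h; if h = h′p, a witness j for h′ lifts
  -- through C(2h′p, (2j+1)p) ≡ C(2h′, 2j+1) with (2j+1)p = 2(jp + half) + 1.
  C[2h][1+2j]≢0 : ∀ h → 0 < h → ∃ λ j → ¬ (2 ℕ.* h) Cℤ suc (2 ℕ.* j) ≡ 0ℤ mod p
  C[2h][1+2j]≢0 = <-rec _ step
    where
    step : ∀ h → (∀ {h′} → h′ < h → 0 < h′ → ∃ λ j → ¬ (2 ℕ.* h′) Cℤ suc (2 ℕ.* j) ≡ 0ℤ mod p) →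
           0 < h → ∃ λ j → ¬ (2 ℕ.* h) Cℤ suc (2 ℕ.* j) ≡ 0ℤ mod p
    step h rec 0<h with p ∣? h
    ... | no p∤h = 0 , λ C[2h]1≡0 → ≢0-mod-product p-prime 2≢0-mod (λ h≡0 → p∤h (≡0-mod⇒∣ h≡0))
                         (subst (_≡ 0ℤ mod p) (trans (cong +_ (nC1≡n (2 ℕ.* h))) (pos-* 2 h)) C[2h]1≡0)
    ... | yes (divides h′ refl) = descend (rec h′<h′*p 0<h′)
      where
      0<h′ : 0 < h′
      0<h′ = ℕₚ.n≢0⇒n>0 (λ { refl → ℕₚ.<-irrefl refl 0<h })
      h′<h′*p : h′ < h′ ℕ.* p
      h′<h′*p = ℕₚ.m<m*n h′ p {{ℕ.>-nonZero 0<h′}} 1<p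
      lift : ∀ j → (2 ℕ.* (h′ ℕ.* p)) Cℤ suc (2 ℕ.* (j ℕ.* p ℕ.+ half)) ≡ (2 ℕ.* h′) Cℤ suc (2 ℕ.* j) mod p
      lift j = subst₂ (λ a b → a Cℤ b ≡ (2 ℕ.* h′) Cℤ suc (2 ℕ.* j) mod p)
                      (ℕₚ.*-assoc 2 h′ p) ([1+2j]*p≡1+2[jp+half] j) ([ap]C[jp]≡aCj (2 ℕ.* h′) (suc (2 ℕ.* j)))
      descend : (∃ λ j → ¬ (2 ℕ.* h′) Cℤ suc (2 ℕ.* j) ≡ 0ℤ mod p) →
                ∃ λ j → ¬ (2 ℕ.* (h′ ℕ.* p)) Cℤ suc (2 ℕ.* j) ≡ 0ℤ mod p
      descend (j , C≢0) = j ℕ.* p ℕ.+ half , λ C≡0 → C≢0 (mod-trans (mod-sym (lift j)) C≡0)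

  -- By Pascal, C(2m+1,2j+1) - C(2m+1,2j) = C(2m,2j+1) - C(2m,2j-1): the odd coefficients telescope.
  C[2m][1+2j]≡0 : ∀ m → (∀ j → suc (2 ℕ.* m) Cℤ suc (2 ℕ.* j) ≡ suc (2 ℕ.* m) Cℤ (2 ℕ.* j) mod p) →
                  ∀ j → (2 ℕ.* m) Cℤ suc (2 ℕ.* j) ≡ 0ℤ mod p
  C[2m][1+2j]≡0 m odd≡even zero    =
    +-cancelˡ-mod 1ℤ (mod-trans (mod-reflexive (sym (Cℤ-pascal (2 ℕ.* m) 0))) (odd≡even 0))
  C[2m][1+2j]≡0 m odd≡even (suc j) =
    subst (λ i → N Cℤ suc i ≡ 0ℤ mod p) (sym (ℕₚ.*-suc 2 j)) (+-cancelˡ-mod (N Cℤ e) (begin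
      N Cℤ e + N Cℤ suc e            ≡⟨ Cℤ-pascal N e ⟨
      suc N Cℤ suc e                 ≈⟨ subst (λ i → suc N Cℤ suc i ≡ suc N Cℤ i mod p) (ℕₚ.*-suc 2 j) (odd≡even (suc j)) ⟩
      suc N Cℤ e                     ≡⟨ Cℤ-pascal N (suc (2 ℕ.* j)) ⟩
      N Cℤ suc (2 ℕ.* j) + N Cℤ e    ≡⟨ +-comm (N Cℤ suc (2 ℕ.* j)) (N Cℤ e) ⟩
      N Cℤ e + N Cℤ suc (2 ℕ.* j)    ≈⟨ +-cong-mod (mod-refl {x = N Cℤ e}) (C[2m][1+2j]≡0 m odd≡even j) ⟩
      N Cℤ e + 0ℤ                    ∎))
    where
    open import Relation.Binary.Reasoning.Setoid (mod-setoid p)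
    N e : ℕ
    N = 2 ℕ.* m
    e = suc (suc (2 ℕ.* j))

  odd≡even⇒m≡0 : ∀ m → (∀ j → suc (2 ℕ.* m) Cℤ suc (2 ℕ.* j) ≡ suc (2 ℕ.* m) Cℤ (2 ℕ.* j) mod p) → m ≡ 0
  odd≡even⇒m≡0 zero     _        = refl
  odd≡even⇒m≡0 (suc m′) odd≡even with C[2h][1+2j]≢0 (suc m′) (s≤s z≤n)
  ... | j , C≢0 = contradiction (C[2m][1+2j]≡0 (suc m′) odd≡even j) C≢0

module Coefficients where

  open import Data.Integer using (ℤ; +_; 0ℤ; 1ℤ; _+_; _-_; _*_; -_)
  open import Data.Integer.Properties using (pos-*; *-identityʳ)
  open import Data.Integer.Tactic.RingSolver using (solve-∀)
  import Data.Nat.Tactic.RingSolver as ℕ-Solver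

  -- The coefficient of x^i in f_{n,k}, after merging its two sums by Pascal's rule.
  coeff : ℕ → ℕ → ℕ → ℤ
  coeff n k i = + k * n Cℤ suc (2 ℕ.* i) + (+ 2 - + k) * n Cℤ (2 ℕ.* i)

  prevTerm≡shiftedCℤ : ∀ n i → + prevTerm (suc n) i ≡ shiftedCℤ 1 n (2 ℕ.* i)
  prevTerm≡shiftedCℤ n zero    = refl
  prevTerm≡shiftedCℤ n (suc i) =
    cong (shiftedCℤ 1 n) (sym (trans (ℕₚ.*-suc 2 i) (cong suc (ℕₚ.+-comm 1 (2 ℕ.* i)))))

  fCoeffℤ≡coeff : ∀ n k i → fCoeffℤ (suc n) k i ≡ coeff (suc n) k i
  fCoeffℤ≡coeff n k i = begin
    fCoeffℤ (suc n) k i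
      ≡⟨ cong₂ (λ a b → a - b + + (2 ℕ.* (suc n C (2 ℕ.* i))))
               (trans (pos-* k (n C (2 ℕ.* i ℕ.+ 1))) (cong (λ t → + k * n Cℤ t) (ℕₚ.+-comm (2 ℕ.* i) 1)))
               (trans (pos-* k (prevTerm (suc n) i)) (cong (+ k *_) (prevTerm≡shiftedCℤ n i))) ⟩
    + k * n Cℤ suc (2 ℕ.* i) - + k * s + + (2 ℕ.* (suc n C (2 ℕ.* i)))
      ≡⟨ cong (_+_ (+ k * n Cℤ suc (2 ℕ.* i) - + k * s))
              (trans (pos-* 2 (suc n C (2 ℕ.* i))) (cong (+ 2 *_) (shiftedCℤ-pascal 0 n (2 ℕ.* i)))) ⟩
    + k * n Cℤ suc (2 ℕ.* i) - + k * s + + 2 * (n Cℤ (2 ℕ.* i) + s)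
      ≡⟨ regroup (+ k) (n Cℤ suc (2 ℕ.* i)) (n Cℤ (2 ℕ.* i)) s ⟩
    + k * (n Cℤ suc (2 ℕ.* i) + n Cℤ (2 ℕ.* i)) + (+ 2 - + k) * (n Cℤ (2 ℕ.* i) + s)
      ≡⟨ cong₂ (λ a b → + k * a + (+ 2 - + k) * b) (shiftedCℤ-pascal 0 n (suc (2 ℕ.* i))) (shiftedCℤ-pascal 0 n (2 ℕ.* i)) ⟨
    coeff (suc n) k i ∎
    where
    open ≡-Reasoning
    s : ℤ
    s = shiftedCℤ 1 n (2 ℕ.* i)
    regroup : ∀ k a b s → k * a - k * s + + 2 * (b + s) ≡ k * (a + b) + (+ 2 - k) * (b + s)
    regroup = solve-∀

  m<i⇒1+2m<2i : ∀ {m i} → m < i → suc (2 ℕ.* m) < 2 ℕ.* i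
  m<i⇒1+2m<2i {m} {i} m<i = subst (ℕ._≤ 2 ℕ.* i) (ℕₚ.*-suc 2 m) (ℕₚ.*-monoʳ-≤ 2 m<i)

  -- For n = 2m + 1 these are the coefficients read backwards (coeff-mirror).
  coeffᴿ : ℕ → ℕ → ℕ → ℤ
  coeffᴿ n k i = + k * n Cℤ (2 ℕ.* i) + (+ 2 - + k) * n Cℤ suc (2 ℕ.* i)

  private
    annihilate : ∀ k → k * 0ℤ + (+ 2 - k) * 0ℤ ≡ 0ℤ
    annihilate = solve-∀

  module _ (m : ℕ) where

    private
      n : ℕ
      n = suc (2 ℕ.* m)

    coeff-vanish : ∀ k {i} → m < i → coeff n k i ≡ 0ℤ
    coeff-vanish k m<i = trans (cong₂ (λ a b → + k * a + (+ 2 - + k) * b)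
                                      (Cℤ-vanish (ℕₚ.m<n⇒m<1+n (m<i⇒1+2m<2i m<i))) (Cℤ-vanish (m<i⇒1+2m<2i m<i)))
                               (annihilate (+ k))

    C[n][2i]≡C[n][1+2j] : ∀ i j → i ℕ.+ j ≡ m → n Cℤ (2 ℕ.* i) ≡ n Cℤ suc (2 ℕ.* j)
    C[n][2i]≡C[n][1+2j] i j refl = cong +_
      (subst (λ n → n C (2 ℕ.* i) ≡ n C suc (2 ℕ.* j)) (sym (split i j)) ([i+j]Ci≡[i+j]Cj (2 ℕ.* i) (suc (2 ℕ.* j))))
      where
      split : ∀ i j → suc (2 ℕ.* (i ℕ.+ j)) ≡ 2 ℕ.* i ℕ.+ suc (2 ℕ.* j)
      split = ℕ-Solver.solve-∀

    coeff-mirror : ∀ k i j → i ℕ.+ j ≡ m → coeff n k j ≡ coeffᴿ n k i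
    coeff-mirror k i j i+j≡m = cong₂ (λ a b → + k * a + (+ 2 - + k) * b)
      (sym (C[n][2i]≡C[n][1+2j] i j i+j≡m)) (C[n][2i]≡C[n][1+2j] j i (trans (ℕₚ.+-comm j i) i+j≡m))

    coeff-top : ∀ k → coeff n k m ≡ + k + (+ 2 - + k) * + n
    coeff-top k = begin
      coeff n k m                           ≡⟨ coeff-mirror k 0 m refl ⟩
      + k * 1ℤ + (+ 2 - + k) * n Cℤ 1       ≡⟨ cong₂ (λ a b → a + (+ 2 - + k) * b) (*-identityʳ (+ k)) (cong +_ (nC1≡n n)) ⟩
      + k + (+ 2 - + k) * + n               ∎
      where open ≡-Reasoning

    coeff-difference : ∀ k i j → i ℕ.+ j ≡ m →
      coeff n k i - coeff n k j ≡ + 2 * (+ k - 1ℤ) * (n Cℤ suc (2 ℕ.* i) - n Cℤ (2 ℕ.* i))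
    coeff-difference k i j i+j≡m = trans (cong (_-_ (coeff n k i)) (coeff-mirror k i j i+j≡m))
      (factor (+ k) (n Cℤ suc (2 ℕ.* i)) (n Cℤ (2 ℕ.* i)))
      where
      factor : ∀ k a b → (k * a + (+ 2 - k) * b) - (k * b + (+ 2 - k) * a) ≡ + 2 * (k - 1ℤ) * (a - b)
      factor = solve-∀

    coeffᴿ-vanish : ∀ k {i} → m < i → coeffᴿ n k i ≡ 0ℤ
    coeffᴿ-vanish k m<i = trans (cong₂ (λ a b → + k * a + (+ 2 - + k) * b)
                                       (Cℤ-vanish (m<i⇒1+2m<2i m<i)) (Cℤ-vanish (ℕₚ.m<n⇒m<1+n (m<i⇒1+2m<2i m<i))))
                                (annihilate (+ k))

  coeff-bottom : ∀ n k → coeff n k 0 ≡ + k * + n + (+ 2 - + k)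
  coeff-bottom n k = cong₂ (λ a b → + k * a + b) (cong +_ (nC1≡n n)) (*-identityʳ (+ 2 - + k))

  coeff-k≡0 : ∀ n i → coeff n 0 i ≡ + 2 * n Cℤ (2 ℕ.* i)
  coeff-k≡0 n i = drop (n Cℤ suc (2 ℕ.* i)) (n Cℤ (2 ℕ.* i))
    where
    drop : ∀ a b → 0ℤ * a + (+ 2 - 0ℤ) * b ≡ + 2 * b
    drop = solve-∀

  -- For n = 2m + 1, gap n k i = a_i - a_{m-1-i}.
  gap : ℕ → ℕ → ℕ → ℤ
  gap n k i = coeff n k i - coeffᴿ n k (suc i)

  -- oddCℤ M j is C(M, 2j − 3), which is 0 for j ≤ 1.
  oddCℤ : ℕ → ℕ → ℤ
  oddCℤ M j = shiftedCℤ 3 M (2 ℕ.* j)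

  oddCℤ[2+j]≡C[1+2j] : ∀ M j → oddCℤ M (2 ℕ.+ j) ≡ M Cℤ suc (2 ℕ.* j)
  oddCℤ[2+j]≡C[1+2j] M j = cong (shiftedCℤ 3 M) (ℕₚ.*-distribˡ-+ 2 2 j)

  gap[3+M]3-expansion : ∀ M i →
    gap (3 ℕ.+ M) 3 i ≡ oddCℤ M (3 ℕ.+ i) - + 3 * oddCℤ M (2 ℕ.+ i) + + 3 * oddCℤ M (1 ℕ.+ i) - oddCℤ M i
  gap[3+M]3-expansion M i = begin
    gap (3 ℕ.+ M) 3 i
      ≡⟨ cong (λ t → coeff (3 ℕ.+ M) 3 i - (+ 3 * C t + - 1ℤ * C (suc t))) (ℕₚ.*-suc 2 i) ⟩
    (+ 3 * C (1 ℕ.+ T) + - 1ℤ * C T) - (+ 3 * C (2 ℕ.+ T) + - 1ℤ * C (3 ℕ.+ T))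
      ≡⟨ cong₂ (λ a b → a - b)
           (cong₂ (λ a b → + 3 * a + - 1ℤ * b) ([3+M]Ct-expansion M (1 ℕ.+ T)) ([3+M]Ct-expansion M T))
           (cong₂ (λ a b → + 3 * a + - 1ℤ * b) ([3+M]Ct-expansion M (2 ℕ.+ T)) ([3+M]Ct-expansion M (3 ℕ.+ T))) ⟩
    (+ 3 * (y 4 + + 3 * y 3 + + 3 * y 2 + y 1) + - 1ℤ * (y 3 + + 3 * y 2 + + 3 * y 1 + y 0))
      - (+ 3 * (y 5 + + 3 * y 4 + + 3 * y 3 + y 2) + - 1ℤ * (y 6 + + 3 * y 5 + + 3 * y 4 + y 3))
      ≡⟨ third-difference (y 0) (y 1) (y 2) (y 3) (y 4) (y 5) (y 6) ⟩
    y 6 - + 3 * y 4 + + 3 * y 2 - y 0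
      ≡⟨ cong₂ (λ a b → a - + 3 * b + + 3 * y 2 - y 0) (reindex 3) (reindex 2) ⟩
    oddCℤ M (3 ℕ.+ i) - + 3 * oddCℤ M (2 ℕ.+ i) + + 3 * y 2 - y 0
      ≡⟨ cong (λ a → oddCℤ M (3 ℕ.+ i) - + 3 * oddCℤ M (2 ℕ.+ i) + + 3 * a - y 0) (reindex 1) ⟩
    oddCℤ M (3 ℕ.+ i) - + 3 * oddCℤ M (2 ℕ.+ i) + + 3 * oddCℤ M (1 ℕ.+ i) - oddCℤ M i ∎
    where
    open ≡-Reasoning
    T : ℕ
    T = 2 ℕ.* i
    C : ℕ → ℤ
    C t = (3 ℕ.+ M) Cℤ t
    y : ℕ → ℤ
    y c = shiftedCℤ 3 M (c ℕ.+ T)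
    reindex : ∀ c → y (2 ℕ.* c) ≡ oddCℤ M (c ℕ.+ i)
    reindex c = cong (shiftedCℤ 3 M) (sym (ℕₚ.*-distribˡ-+ 2 c i))
    third-difference : ∀ y₀ y₁ y₂ y₃ y₄ y₅ y₆ →
      (+ 3 * (y₄ + + 3 * y₃ + + 3 * y₂ + y₁) + - 1ℤ * (y₃ + + 3 * y₂ + + 3 * y₁ + y₀))
        - (+ 3 * (y₅ + + 3 * y₄ + + 3 * y₃ + y₂) + - 1ℤ * (y₆ + + 3 * y₅ + + 3 * y₄ + y₃))
      ≡ y₆ - + 3 * y₄ + + 3 * y₂ - y₀
    third-difference = solve-∀

  -- Both identities eliminate C(n,2) and C(n,3) via 2C(n,2) = n(n-1) and 6C(n,3) = n(n-1)(n-2);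
  -- the last factor is the leading coefficient a_m (coeff-top).
  4n[n-1][n+1]-combination : ∀ n k → let K = + k ; N = + n in
    + 4 * (N * (N - 1ℤ) * (N + 1ℤ)) ≡
      + 6 * (N - 1ℤ) * coeffᴿ n k 1 + (+ 3 * (N * (N - 1ℤ)) - N * (N - 1ℤ) * (N - + 2)) * (K + (+ 2 - K) * N)
  4n[n-1][n+1]-combination n k = begin
    + 4 * (N * (N - 1ℤ) * (N + 1ℤ))
      ≡⟨ eliminate K N ⟩
    (N - 1ℤ) * (+ 3 * K * B + (+ 2 - K) * A) + (+ 3 * B - A) * top
      ≡⟨ cong₂ (λ b a → (N - 1ℤ) * (+ 3 * K * b + (+ 2 - K) * a) + (+ 3 * B - A) * top)
               (2*nC2≡n*[n-1] n) (6*nC3≡n*[n-1]*[n-2] n) ⟨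
    (N - 1ℤ) * (+ 3 * K * (+ 2 * c₂) + (+ 2 - K) * (+ 6 * c₃)) + (+ 3 * B - A) * top
      ≡⟨ regroup K N c₂ c₃ (+ 3 * B - A) top ⟩
    + 6 * (N - 1ℤ) * (K * c₂ + (+ 2 - K) * c₃) + (+ 3 * B - A) * top ∎
    where
    open ≡-Reasoning
    K N c₂ c₃ A B top : ℤ
    K = + k
    N = + n
    c₂ = n Cℤ 2
    c₃ = n Cℤ 3
    B = N * (N - 1ℤ)
    A = N * (N - 1ℤ) * (N - + 2)
    top = K + (+ 2 - K) * N
    eliminate : ∀ K N → + 4 * (N * (N - 1ℤ) * (N + 1ℤ)) ≡
      (N - 1ℤ) * (+ 3 * K * (N * (N - 1ℤ)) + (+ 2 - K) * (N * (N - 1ℤ) * (N - + 2)))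
        + (+ 3 * (N * (N - 1ℤ)) - N * (N - 1ℤ) * (N - + 2)) * (K + (+ 2 - K) * N)
    eliminate = solve-∀
    regroup : ∀ K N c₂ c₃ u v → (N - 1ℤ) * (+ 3 * K * (+ 2 * c₂) + (+ 2 - K) * (+ 6 * c₃)) + u * v ≡
      + 6 * (N - 1ℤ) * (K * c₂ + (+ 2 - K) * c₃) + u * v
    regroup = solve-∀

  4[n-1][n+1][n-3]-combination : ∀ n k → let K = + k ; N = + n in
    + 4 * ((N - 1ℤ) * (N + 1ℤ) * (N - + 3)) ≡
      - (+ 6 * (N - 1ℤ)) * gap n k 0
        + (+ 6 - + 6 * N + + 3 * (N * (N - 1ℤ)) - N * (N - 1ℤ) * (N - + 2)) * (K + (+ 2 - K) * N)
  4[n-1][n+1][n-3]-combination n k = begin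
    + 4 * ((N - 1ℤ) * (N + 1ℤ) * (N - + 3))
      ≡⟨ eliminate K N ⟩
    - (N - 1ℤ) * (+ 6 * (K * N + (+ 2 - K)) - (+ 3 * K * B + (+ 2 - K) * A)) + γ * top
      ≡⟨ cong₂ (λ b a → - (N - 1ℤ) * (+ 6 * (K * N + (+ 2 - K)) - (+ 3 * K * b + (+ 2 - K) * a)) + γ * top)
               (2*nC2≡n*[n-1] n) (6*nC3≡n*[n-1]*[n-2] n) ⟨
    - (N - 1ℤ) * (+ 6 * (K * N + (+ 2 - K)) - (+ 3 * K * (+ 2 * c₂) + (+ 2 - K) * (+ 6 * c₃))) + γ * top
      ≡⟨ regroup K N c₂ c₃ γ top ⟩
    - (+ 6 * (N - 1ℤ)) * (K * N + (+ 2 - K) - coeffᴿ n k 1) + γ * top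
      ≡⟨ cong (λ a → - (+ 6 * (N - 1ℤ)) * (a - coeffᴿ n k 1) + γ * top) (coeff-bottom n k) ⟨
    - (+ 6 * (N - 1ℤ)) * gap n k 0 + γ * top ∎
    where
    open ≡-Reasoning
    K N c₂ c₃ A B γ top : ℤ
    K = + k
    N = + n
    c₂ = n Cℤ 2
    c₃ = n Cℤ 3
    B = N * (N - 1ℤ)
    A = N * (N - 1ℤ) * (N - + 2)
    γ = + 6 - + 6 * N + + 3 * B - A
    top = K + (+ 2 - K) * N
    eliminate : ∀ K N → + 4 * ((N - 1ℤ) * (N + 1ℤ) * (N - + 3)) ≡
      - (N - 1ℤ) * (+ 6 * (K * N + (+ 2 - K)) - (+ 3 * K * (N * (N - 1ℤ)) + (+ 2 - K) * (N * (N - 1ℤ) * (N - + 2))))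
        + (+ 6 - + 6 * N + + 3 * (N * (N - 1ℤ)) - N * (N - 1ℤ) * (N - + 2)) * (K + (+ 2 - K) * N)
    eliminate = solve-∀
    regroup : ∀ K N c₂ c₃ u v →
      - (N - 1ℤ) * (+ 6 * (K * N + (+ 2 - K)) - (+ 3 * K * (+ 2 * c₂) + (+ 2 - K) * (+ 6 * c₃))) + u * v ≡
      - (+ 6 * (N - 1ℤ)) * (K * N + (+ 2 - K) - (K * c₂ + (+ 2 - K) * c₃)) + u * v
    regroup = solve-∀

open Coefficients

module SelfReciprocity where

  open import Data.Integer using (ℤ; 0ℤ; _%ℕ_)
  open import Data.Nat.Divisibility using (_∣_; _∣?_; divides)

  record SelfReciprocalMod (p : ℕ) (a : ℕ → ℤ) : Set where
    field
      degree    : ℕ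
      leading≢0 : ¬ a degree ≡ 0ℤ mod p
      vanishes  : ∀ i → degree < i → a i ≡ 0ℤ mod p
      symmetric : ∀ i → i ≤ degree → a i ≡ a (degree ∸ i) mod p

  open SelfReciprocalMod public

  module _ {p : ℕ} .{{_ : NonZero p}} where

    SelfReciprocal⇔SelfReciprocalMod : ∀ a → SelfReciprocal (λ i → a i %ℕ p) ⇔ SelfReciprocalMod p a
    SelfReciprocal⇔SelfReciprocalMod a = mk⇔
      (λ (d , a[d]≢0 , vanish , symm) → record
        { degree    = d
        ; leading≢0 = λ a[d]≡0 → a[d]≢0 (to≡0 a[d]≡0)
        ; vanishes  = λ i d<i → from≡0 (vanish i d<i)
        ; symmetric = λ i i≤d → Equivalence.to (%ℕ-≡⇔≡-mod (a i) (a (d ∸ i))) (symm i i≤d)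
        })
      (λ sr → degree sr
            , (λ a[d]≡0 → leading≢0 sr (from≡0 a[d]≡0))
            , (λ i d<i → to≡0 (vanishes sr i d<i))
            , (λ i i≤d → Equivalence.from (%ℕ-≡⇔≡-mod _ _) (symmetric sr i i≤d)))
      where
      to≡0 : ∀ {x} → x ≡ 0ℤ mod p → x %ℕ p ≡ 0
      to≡0 {x} = Equivalence.from (%ℕ≡0⇔≡0-mod x)
      from≡0 : ∀ {x} → x %ℕ p ≡ 0 → x ≡ 0ℤ mod p
      from≡0 {x} = Equivalence.to (%ℕ≡0⇔≡0-mod x)

  module _ {p : ℕ} {a : ℕ → ℤ} where

    SelfReciprocalMod-resp : ∀ {b} → (∀ i → a i ≡ b i mod p) → SelfReciprocalMod p a → SelfReciprocalMod p b
    SelfReciprocalMod-resp a≡b sr = record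
      { degree    = degree sr
      ; leading≢0 = λ b[d]≡0 → leading≢0 sr (mod-trans (a≡b _) b[d]≡0)
      ; vanishes  = λ i d<i → mod-trans (mod-sym (a≡b i)) (vanishes sr i d<i)
      ; symmetric = λ i i≤d → mod-trans (mod-sym (a≡b i)) (mod-trans (symmetric sr i i≤d) (a≡b _))
      }

    constant-SelfReciprocalMod : ¬ a 0 ≡ 0ℤ mod p → (∀ i → 0 < i → a i ≡ 0ℤ mod p) → SelfReciprocalMod p a
    constant-SelfReciprocalMod a₀≢0 vanish = record
      { degree    = 0
      ; leading≢0 = a₀≢0
      ; vanishes  = vanish
      ; symmetric = λ { 0 z≤n → mod-refl }
      }

    degree-unique : ∀ {m} → (sr : SelfReciprocalMod p a) → ¬ a m ≡ 0ℤ mod p →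
                    (∀ i → m < i → a i ≡ 0ℤ mod p) → degree sr ≡ m
    degree-unique {m} sr a[m]≢0 vanish with ℕₚ.<-cmp (degree sr) m
    ... | tri< d<m _ _ = contradiction (vanishes sr m d<m) a[m]≢0
    ... | tri≈ _ d≡m _ = d≡m
    ... | tri> _ _ m<d = contradiction (vanish (degree sr) m<d) (leading≢0 sr)

    stretch : ∀ {b} q .{{_ : NonZero q}} → (∀ i → b (i ℕ.* q) ≡ a i mod p) → (∀ j → ¬ q ∣ j → b j ≡ 0ℤ mod p) →
              SelfReciprocalMod p b → SelfReciprocalMod p a
    stretch {b} q b[iq]≡a[i] b≡0 sr with q ∣? degree sr
    ... | no q∤d = contradiction (b≡0 (degree sr) q∤d) (leading≢0 sr)
    ... | yes (divides d d≡dq) = record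
      { degree    = d
      ; leading≢0 = λ a[d]≡0 → leading≢0 sr (subst (λ t → b t ≡ 0ℤ mod p) (sym d≡dq) (mod-trans (b[iq]≡a[i] d) a[d]≡0))
      ; vanishes  = λ i d<i → mod-trans (mod-sym (b[iq]≡a[i] i))
                               (vanishes sr (i ℕ.* q) (subst (_< i ℕ.* q) (sym d≡dq) (ℕₚ.*-monoˡ-< q d<i)))
      ; symmetric = λ i i≤d → mod-trans (mod-sym (b[iq]≡a[i] i))
                                (mod-trans (symmetric-at i i≤d) (b[iq]≡a[i] (d ∸ i)))
      }
      where
      symmetric-at : ∀ i → i ≤ d → b (i ℕ.* q) ≡ b ((d ∸ i) ℕ.* q) mod p
      symmetric-at i i≤d = subst (λ t → b (i ℕ.* q) ≡ b t mod p)
        (trans (cong (_∸ i ℕ.* q) d≡dq) (sym (ℕₚ.*-distribʳ-∸ q d i)))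
        (symmetric sr (i ℕ.* q) (subst (i ℕ.* q ≤_) (sym d≡dq) (ℕₚ.*-monoˡ-≤ q i≤d)))

open SelfReciprocity

even⊎odd : ∀ q → (∃ λ h → q ≡ 2 ℕ.* h) ⊎ (∃ λ h → q ≡ suc (2 ℕ.* h))
even⊎odd zero    = inj₁ (0 , refl)
even⊎odd (suc q) with even⊎odd q
... | inj₁ (h , refl) = inj₂ (h , refl)
... | inj₂ (h , refl) = inj₁ (suc h , sym (ℕₚ.*-suc 2 h))

module Classification {p : ℕ} (p-prime : Prime p) (p-odd : p % 2 ≡ 1) where

  open import Data.Integer using (ℤ; +_; 0ℤ; 1ℤ; _+_; _-_; _*_; -_)
  open import Data.Integer.Properties using (pos-+; +-identityˡ; *-zeroˡ)
  open import Data.Integer.Tactic.RingSolver using (solve-∀)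
  open import Data.Nat.Divisibility using (_∣_; divides; ∣-refl)
  open import Data.Nat.Induction using (<-rec)
  import Data.Nat.Tactic.RingSolver as ℕ-Solver
  open LucasCongruences p-prime
  open OddPrimeBinomials p-prime p-odd

  4≢0-mod : ¬ + 4 ≡ 0ℤ mod p
  4≢0-mod = ≢0-mod-product p-prime 2≢0-mod 2≢0-mod

  3≢0⇒3<p : ¬ + 3 ≡ 0ℤ mod p → 3 < p
  3≢0⇒3<p 3≢0 with ℕₚ.<-cmp 3 p
  ... | tri< 3<p _ _ = 3<p
  ... | tri≈ _ refl _ = contradiction (∣⇒≡0-mod ∣-refl) 3≢0
  ... | tri> _ _ p<3 = contradiction (odd-prime⇒2<p p-prime p-odd) (ℕₚ.<⇒≱ p<3)

  2[k-1]≢0-mod : ∀ {k} → k < p → k ≢ 1 → ¬ + 2 * (+ k - 1ℤ) ≡ 0ℤ mod p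
  2[k-1]≢0-mod k<p k≢1 = ≢0-mod-product p-prime 2≢0-mod (λ k-1≡0 → k≢1 (≡-mod⇒≡ k<p 1<p (i-j≡0⇒i≡j-mod k-1≡0)))

  q*p≡1+2a⇒q-odd : ∀ {q a} → q ℕ.* p ≡ suc (2 ℕ.* a) → ∃ λ h → q ≡ suc (2 ℕ.* h)
  q*p≡1+2a⇒q-odd {q} {a} q*p≡1+2a with even⊎odd q
  ... | inj₂ q-odd      = q-odd
  ... | inj₁ (h , refl) = contradiction (trans (sym (ℕₚ.*-assoc 2 h p)) q*p≡1+2a) (ℕₚ.even≢odd (h ℕ.* p) a)

  q*p≡2a⇒q-even : ∀ {q a} → q ℕ.* p ≡ 2 ℕ.* a → ∃ λ h → q ≡ 2 ℕ.* h
  q*p≡2a⇒q-even {q} {a} q*p≡2a with even⊎odd q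
  ... | inj₁ q-even     = q-even
  ... | inj₂ (h , refl) = contradiction (trans (sym q*p≡2a) ([1+2j]*p≡1+2[jp+half] h)) (ℕₚ.even≢odd a (h ℕ.* p ℕ.+ half))

  p^l-odd : ∀ l → ∃ λ h → p ^ l ≡ suc (2 ℕ.* h)
  p^l-odd zero    = 0 , refl
  p^l-odd (suc l) with p^l-odd l
  ... | h , p^l≡1+2h = h ℕ.* p ℕ.+ half , trans (cong (p ℕ.*_) p^l≡1+2h) (trans (ℕₚ.*-comm p _) ([1+2j]*p≡1+2[jp+half] h))

  p∣n+1⇔n+1≡2lp : ∀ m → p ∣ suc (2 ℕ.* m) ℕ.+ 1 ⇔ (∃ λ l → 1 ≤ l × suc (2 ℕ.* m) ℕ.+ 1 ≡ 2 ℕ.* l ℕ.* p)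
  p∣n+1⇔n+1≡2lp m = mk⇔ to (λ (l , _ , n+1≡2lp) → divides (2 ℕ.* l) n+1≡2lp)
    where
    n+1≡2[m+1] : ∀ m → suc (2 ℕ.* m) ℕ.+ 1 ≡ 2 ℕ.* suc m
    n+1≡2[m+1] = ℕ-Solver.solve-∀
    to : p ∣ suc (2 ℕ.* m) ℕ.+ 1 → ∃ λ l → 1 ≤ l × suc (2 ℕ.* m) ℕ.+ 1 ≡ 2 ℕ.* l ℕ.* p
    to (divides q n+1≡qp) with q*p≡2a⇒q-even {q} {suc m} (trans (sym n+1≡qp) (n+1≡2[m+1] m))
    ... | zero  , refl = contradiction n+1≡qp λ ()
    ... | suc l , refl = suc l , s≤s z≤n , n+1≡qp

  top[k≡1]≡n+1 : ∀ m → coeff (suc (2 ℕ.* m)) 1 m ≡ + (suc (2 ℕ.* m) ℕ.+ 1)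
  top[k≡1]≡n+1 m = trans (coeff-top m 1) (trans (simplify (+ suc (2 ℕ.* m))) (sym (pos-+ (suc (2 ℕ.* m)) 1)))
    where
    simplify : ∀ N → + 1 + (+ 2 - + 1) * N ≡ N + + 1
    simplify = solve-∀

  top≢0⇒k≡1⊎m≡0 : ∀ m k → k < p → ¬ coeff (suc (2 ℕ.* m)) k m ≡ 0ℤ mod p →
                   SelfReciprocalMod p (coeff (suc (2 ℕ.* m)) k) → k ≡ 1 ⊎ m ≡ 0
  top≢0⇒k≡1⊎m≡0 m k k<p top≢0 sr with k ℕ.≟ 1
  ... | yes k≡1 = inj₁ k≡1
  ... | no  k≢1 = inj₂ (odd≡even⇒m≡0 m odd≡even)
    where
    n : ℕ
    n = suc (2 ℕ.* m)
    d≡m : degree sr ≡ m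
    d≡m = degree-unique sr top≢0 (λ i m<i → mod-reflexive (coeff-vanish m k m<i))
    symmetric-about-m : ∀ j → j ≤ m → coeff n k j ≡ coeff n k (m ∸ j) mod p
    symmetric-about-m j = subst (λ d → j ≤ d → coeff n k j ≡ coeff n k (d ∸ j) mod p) d≡m (symmetric sr j)
    odd≡even : ∀ j → n Cℤ suc (2 ℕ.* j) ≡ n Cℤ (2 ℕ.* j) mod p
    odd≡even j with ℕₚ.≤-<-connex j m
    ... | inj₁ j≤m = i-j≡0⇒i≡j-mod (≡0-mod-cancelˡ p-prime (2[k-1]≢0-mod k<p k≢1)
          (subst (_≡ 0ℤ mod p) (coeff-difference m k j (m ∸ j) (ℕₚ.m+[n∸m]≡n j≤m))
                 (i≡j⇒i-j≡0-mod (symmetric-about-m j j≤m))))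
    ... | inj₂ m<j = mod-reflexive (trans (Cℤ-vanish (ℕₚ.m<n⇒m<1+n (m<i⇒1+2m<2i m<j))) (sym (Cℤ-vanish (m<i⇒1+2m<2i m<j))))

  p∣n⇒k≡0 : ∀ m k → k < p → + suc (2 ℕ.* m) ≡ 0ℤ mod p → coeff (suc (2 ℕ.* m)) k m ≡ 0ℤ mod p → k ≡ 0
  p∣n⇒k≡0 m k k<p n≡0 top≡0 = ≡-mod⇒≡ k<p (ℕ.>-nonZero⁻¹ p)
    (≡0-by-combination 1ℤ (- (+ 2 - + k)) (isolate (+ k) (+ suc (2 ℕ.* m))) (subst (_≡ 0ℤ mod p) (coeff-top m k) top≡0) n≡0)
    where
    isolate : ∀ k n → k ≡ 1ℤ * (k + (+ 2 - k) * n) + (- (+ 2 - k)) * n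
    isolate = solve-∀

  -- f_{qp,0}(x) ≡ f_{q,0}(x^p) mod p.
  SelfReciprocal-coeff[qp]⇒coeff[q] : ∀ q → SelfReciprocalMod p (coeff (q ℕ.* p) 0) → SelfReciprocalMod p (coeff q 0)
  SelfReciprocal-coeff[qp]⇒coeff[q] q = stretch p b[ip]≡a[i] b[j]≡0
    where
    b[ip]≡a[i] : ∀ i → coeff (q ℕ.* p) 0 (i ℕ.* p) ≡ coeff q 0 i mod p
    b[ip]≡a[i] i = begin
      coeff (q ℕ.* p) 0 (i ℕ.* p)           ≡⟨ coeff-k≡0 (q ℕ.* p) (i ℕ.* p) ⟩
      + 2 * (q ℕ.* p) Cℤ (2 ℕ.* (i ℕ.* p))  ≡⟨ cong (λ t → + 2 * (q ℕ.* p) Cℤ t) (ℕₚ.*-assoc 2 i p) ⟨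
      + 2 * (q ℕ.* p) Cℤ (2 ℕ.* i ℕ.* p)    ≈⟨ *-congˡ-mod (+ 2) ([ap]C[jp]≡aCj q (2 ℕ.* i)) ⟩
      + 2 * q Cℤ (2 ℕ.* i)                  ≡⟨ coeff-k≡0 q i ⟨
      coeff q 0 i                           ∎
      where open import Relation.Binary.Reasoning.Setoid (mod-setoid p)
    b[j]≡0 : ∀ j → ¬ p ∣ j → coeff (q ℕ.* p) 0 j ≡ 0ℤ mod p
    b[j]≡0 j p∤j = subst (_≡ 0ℤ mod p) (sym (coeff-k≡0 (q ℕ.* p) j))
      (*-≡0-mod (+ 2) (p∤t⇒[ap]Ct≡0 q (λ p∣2j → p∤j (p∣2j⇒p∣j p∣2j))))

  IsPowerOfP : ℕ → Set
  IsPowerOfP n = ∃ λ l → 1 ≤ l × n ≡ p ^ l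

  p∣n⇒n≡p^l : ∀ m → + suc (2 ℕ.* m) ≡ 0ℤ mod p → SelfReciprocalMod p (coeff (suc (2 ℕ.* m)) 0) →
              IsPowerOfP (suc (2 ℕ.* m))
  p∣n⇒n≡p^l = <-rec P descend
    where
    P : ℕ → Set
    P m = + suc (2 ℕ.* m) ≡ 0ℤ mod p → SelfReciprocalMod p (coeff (suc (2 ℕ.* m)) 0) → IsPowerOfP (suc (2 ℕ.* m))
    descend : ∀ m → (∀ {m′} → m′ < m → P m′) → P m
    descend m rec n≡0 sr with ≡0-mod⇒∣ n≡0
    ... | divides q n≡q*p with q*p≡1+2a⇒q-odd {q} {m} (sym n≡q*p)
    ...   | m′ , refl = by-cases (≡0-mod? p (+ q))
      where
      m′<m : m′ < m
      m′<m = ℕₚ.*-cancelˡ-< 2 m′ m (ℕₚ.≤-pred (subst (q <_) (sym n≡q*p) (ℕₚ.m<m*n q p 1<p)))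
      sr′ : SelfReciprocalMod p (coeff q 0)
      sr′ = SelfReciprocal-coeff[qp]⇒coeff[q] q (subst (λ n → SelfReciprocalMod p (coeff n 0)) n≡q*p sr)
      p∣q : IsPowerOfP q → IsPowerOfP (suc (2 ℕ.* m))
      p∣q (l , _ , q≡p^l) = suc l , s≤s z≤n , trans n≡q*p (trans (cong (ℕ._* p) q≡p^l) (ℕₚ.*-comm (p ^ l) p))
      p∤q : ¬ + q ≡ 0ℤ mod p → IsPowerOfP (suc (2 ℕ.* m))
      p∤q q≢0 = [ (λ ()) , (λ m′≡0 → 1 , s≤s z≤n , n≡p^1 m′≡0) ]′
                  (top≢0⇒k≡1⊎m≡0 m′ 0 (ℕ.>-nonZero⁻¹ p) top≢0 sr′)
        where
        top≢0 : ¬ coeff q 0 m′ ≡ 0ℤ mod p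
        top≢0 = subst (λ t → ¬ t ≡ 0ℤ mod p) (sym (trans (coeff-top m′ 0) (+-identityˡ (+ 2 * + q))))
                      (≢0-mod-product p-prime 2≢0-mod q≢0)
        n≡p^1 : m′ ≡ 0 → suc (2 ℕ.* m) ≡ p ^ 1
        n≡p^1 refl = trans n≡q*p (trans (ℕₚ.+-identityʳ p) (sym (ℕₚ.*-identityʳ p)))
      by-cases : Dec (+ q ≡ 0ℤ mod p) → IsPowerOfP (suc (2 ℕ.* m))
      by-cases (yes q≡0) = p∣q (rec m′<m q≡0 sr′)
      by-cases (no  q≢0) = p∤q q≢0

  module _ (m k : ℕ) (top≡0 : coeff (suc (2 ℕ.* m)) k m ≡ 0ℤ mod p) where

    private
      n : ℕ
      n = suc (2 ℕ.* m)
      K N : ℤ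
      K = + k
      N = + n

    top≡0′ : K + (+ 2 - K) * N ≡ 0ℤ mod p
    top≡0′ = subst (_≡ 0ℤ mod p) (coeff-top m k) top≡0

    n-1≢0 : ¬ N - 1ℤ ≡ 0ℤ mod p
    n-1≢0 n-1≡0 = 2≢0-mod (≡0-by-combination 1ℤ (- (+ 2 - K)) (isolate K N) top≡0′ n-1≡0)
      where
      isolate : ∀ K N → + 2 ≡ 1ℤ * (K + (+ 2 - K) * N) + (- (+ 2 - K)) * (N - 1ℤ)
      isolate = solve-∀

    bottom≢0⇒n+1≢0 : ¬ coeff n k 0 ≡ 0ℤ mod p → ¬ N + 1ℤ ≡ 0ℤ mod p
    bottom≢0⇒n+1≢0 bottom≢0 n+1≡0 = bottom≢0 (≡0-by-combination (+ 2) (- 1ℤ)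
      (trans (coeff-bottom n k) (isolate K N)) n+1≡0 top≡0′)
      where
      isolate : ∀ K N → K * N + (+ 2 - K) ≡ + 2 * (N + 1ℤ) + - 1ℤ * (K + (+ 2 - K) * N)
      isolate = solve-∀

    coeff≡0-from-top : ∀ i → m ≤ i → coeff n k i ≡ 0ℤ mod p
    coeff≡0-from-top i m≤i with ℕₚ.m≤n⇒m<n∨m≡n m≤i
    ... | inj₁ m<i = mod-reflexive (coeff-vanish m k m<i)
    ... | inj₂ refl = top≡0

    degree<m : (sr : SelfReciprocalMod p (coeff n k)) → degree sr < m
    degree<m sr with ℕₚ.<-cmp (degree sr) m
    ... | tri< d<m _ _ = d<m
    ... | tri≈ _ d≡m _ = contradiction (subst (λ d → coeff n k d ≡ 0ℤ mod p) (sym d≡m) top≡0) (leading≢0 sr)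
    ... | tri> _ _ m<d = contradiction (mod-reflexive (coeff-vanish m k m<d)) (leading≢0 sr)

    gap≡0 : (sr : SelfReciprocalMod p (coeff n k)) → suc (degree sr) ≡ m → ∀ i → gap n k i ≡ 0ℤ mod p
    gap≡0 sr 1+d≡m i with ℕₚ.≤-<-connex i (degree sr)
    ... | inj₁ i≤d = i≡j⇒i-j≡0-mod (mod-trans (symmetric sr i i≤d) (mod-reflexive
          (coeff-mirror m k (suc i) (degree sr ∸ i) (trans (cong suc (ℕₚ.m+[n∸m]≡n i≤d)) 1+d≡m))))
    ... | inj₂ d<i = ≡0-by-combination 1ℤ (- 1ℤ) (difference (coeff n k i) (coeffᴿ n k (suc i)))
          (coeff≡0-from-top i m≤i) (mod-reflexive (coeffᴿ-vanish m k (s≤s m≤i)))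
      where
      m≤i : m ≤ i
      m≤i = subst (_≤ i) 1+d≡m d<i
      difference : ∀ x y → x - y ≡ 1ℤ * x + - 1ℤ * y
      difference = solve-∀

  a[m-1]≢0 : ∀ m₁ k → let n = suc (2 ℕ.* suc m₁) in
             coeff n k (suc m₁) ≡ 0ℤ mod p → ¬ + n ≡ 0ℤ mod p → ¬ coeff n k 0 ≡ 0ℤ mod p →
             ¬ coeff n k m₁ ≡ 0ℤ mod p
  a[m-1]≢0 m₁ k top≡0 n≢0 bottom≢0 a[m-1]≡0 = ≢0-mod-product p-prime 4≢0-mod
    (≢0-mod-product p-prime (≢0-mod-product p-prime n≢0 (n-1≢0 (suc m₁) k top≡0))
                            (bottom≢0⇒n+1≢0 (suc m₁) k top≡0 bottom≢0))
    (≡0-by-combination (+ 6 * (N - 1ℤ)) (+ 3 * (N * (N - 1ℤ)) - N * (N - 1ℤ) * (N - + 2)) (4n[n-1][n+1]-combination n k)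
      (subst (_≡ 0ℤ mod p) (coeff-mirror (suc m₁) k 1 m₁ refl) a[m-1]≡0) (top≡0′ (suc m₁) k top≡0))
    where
    n : ℕ
    n = suc (2 ℕ.* suc m₁)
    N : ℤ
    N = + n

  gap≡0⇒C[M][1+2j]≡0 : ∀ M → + M ≡ 0ℤ mod p → (∀ i → gap (3 ℕ.+ M) 3 i ≡ 0ℤ mod p) →
                        ∀ j → M Cℤ suc (2 ℕ.* j) ≡ 0ℤ mod p
  gap≡0⇒C[M][1+2j]≡0 M M≡0 gap≡0 j = subst (_≡ 0ℤ mod p) (oddCℤ[2+j]≡C[1+2j] M j)
    (≡0-by-recurrence (oddCℤ M) mod-refl mod-refl (subst (_≡ 0ℤ mod p) (cong +_ (sym (nC1≡n M))) M≡0)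
      (λ i → subst (_≡ 0ℤ mod p) (gap[3+M]3-expansion M i) (gap≡0 i)) (2 ℕ.+ j))

  n-3≡0∧gap≡0⇒n≡3 : ∀ m₁ → + suc (2 ℕ.* suc m₁) - + 3 ≡ 0ℤ mod p →
                     (∀ i → gap (suc (2 ℕ.* suc m₁)) 3 i ≡ 0ℤ mod p) → suc (2 ℕ.* suc m₁) ≡ 3
  n-3≡0∧gap≡0⇒n≡3 zero    _      _     = refl
  n-3≡0∧gap≡0⇒n≡3 (suc r) n-3≡0 gap≡0 with C[2h][1+2j]≢0 (suc r) (s≤s z≤n)
  ... | j , C≢0 = contradiction
        (gap≡0⇒C[M][1+2j]≡0 M M≡0 (λ i → subst (λ n → gap n 3 i ≡ 0ℤ mod p) n≡3+M (gap≡0 i)) j) C≢0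
    where
    M : ℕ
    M = 2 ℕ.* suc r
    split : ∀ r → suc (2 ℕ.* suc (suc r)) ≡ 3 ℕ.+ 2 ℕ.* suc r
    split = ℕ-Solver.solve-∀
    n≡3+M : suc (2 ℕ.* suc (suc r)) ≡ 3 ℕ.+ M
    n≡3+M = split r
    cancel : ∀ x → + 3 + x - + 3 ≡ x
    cancel = solve-∀
    M≡0 : + M ≡ 0ℤ mod p
    M≡0 = subst (_≡ 0ℤ mod p) (trans (cong (λ n → + n - + 3) n≡3+M) (trans (cong (_- + 3) (pos-+ 3 M)) (cancel (+ M)))) n-3≡0

  gap≡0⇒n≡3∧k≡3 : ∀ m₁ k → k < p → let n = suc (2 ℕ.* suc m₁) in
                  coeff n k (suc m₁) ≡ 0ℤ mod p → ¬ + n ≡ 0ℤ mod p → ¬ coeff n k 0 ≡ 0ℤ mod p →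
                  (∀ i → gap n k i ≡ 0ℤ mod p) → n ≡ 3 × k ≡ 3 × 3 < p
  gap≡0⇒n≡3∧k≡3 m₁ k k<p top≡0 n≢0 bottom≢0 gap≡0′ =
    n-3≡0∧gap≡0⇒n≡3 m₁ n-3≡0 (subst (λ k → ∀ i → gap n k i ≡ 0ℤ mod p) k≡3 gap≡0′) , k≡3 , 3<p
    where
    n : ℕ
    n = suc (2 ℕ.* suc m₁)
    N : ℤ
    N = + n
    n-3≡0 : N - + 3 ≡ 0ℤ mod p
    n-3≡0 = ≡0-mod-cancelˡ p-prime
      (≢0-mod-product p-prime (n-1≢0 (suc m₁) k top≡0) (bottom≢0⇒n+1≢0 (suc m₁) k top≡0 bottom≢0))
      (≡0-mod-cancelˡ p-prime 4≢0-mod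
        (≡0-by-combination (- (+ 6 * (N - 1ℤ))) (+ 6 - + 6 * N + + 3 * (N * (N - 1ℤ)) - N * (N - 1ℤ) * (N - + 2))
          (4[n-1][n+1][n-3]-combination n k) (gap≡0′ 0) (top≡0′ (suc m₁) k top≡0)))
    split : ∀ N → N ≡ 1ℤ * (N - + 3) + 1ℤ * + 3
    split = solve-∀
    3<p : 3 < p
    3<p = 3≢0⇒3<p (λ 3≡0 → n≢0 (≡0-by-combination 1ℤ 1ℤ (split N) n-3≡0 3≡0))
    isolate : ∀ K N → + 2 * (+ 3 - K) ≡ 1ℤ * (K + (+ 2 - K) * N) + (- (+ 2 - K)) * (N - + 3)
    isolate = solve-∀
    k≡3 : k ≡ 3
    k≡3 = sym (≡-mod⇒≡ 3<p k<p (i-j≡0⇒i≡j-mod (≡0-mod-cancelˡ p-prime 2≢0-mod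
      (≡0-by-combination 1ℤ (- (+ 2 - + k)) (isolate (+ k) N) (top≡0′ (suc m₁) k top≡0) n-3≡0))))

  p∤n∧top≡0⇒n≡3∧k≡3 : ∀ m k → k < p → ¬ + suc (2 ℕ.* m) ≡ 0ℤ mod p → coeff (suc (2 ℕ.* m)) k m ≡ 0ℤ mod p →
                       SelfReciprocalMod p (coeff (suc (2 ℕ.* m)) k) → suc (2 ℕ.* m) ≡ 3 × k ≡ 3 × 3 < p
  p∤n∧top≡0⇒n≡3∧k≡3 zero     k _   _   top≡0 sr = contradiction (degree<m 0 k top≡0 sr) λ ()
  p∤n∧top≡0⇒n≡3∧k≡3 (suc m₁) k k<p n≢0 top≡0 sr =
    gap≡0⇒n≡3∧k≡3 m₁ k k<p top≡0 n≢0 bottom≢0 (gap≡0 (suc m₁) k top≡0 sr (cong suc d≡m₁))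
    where
    bottom≢0 : ¬ coeff (suc (2 ℕ.* suc m₁)) k 0 ≡ 0ℤ mod p
    bottom≢0 bottom≡0 = leading≢0 sr (mod-trans (mod-sym (symmetric sr 0 z≤n)) bottom≡0)
    d≡m₁ : degree sr ≡ m₁
    d≡m₁ = degree-unique sr (a[m-1]≢0 m₁ k top≡0 n≢0 bottom≢0) (coeff≡0-from-top (suc m₁) k top≡0)

  n≡1⇒SelfReciprocal : ∀ k → SelfReciprocalMod p (coeff 1 k)
  n≡1⇒SelfReciprocal k = constant-SelfReciprocalMod
    (λ a₀≡0 → 2≢0-mod (subst (_≡ 0ℤ mod p) (a₀≡2 (+ k)) a₀≡0))
    (λ i 0<i → mod-reflexive (coeff-vanish 0 k 0<i))
    where
    a₀≡2 : ∀ K → K * + 1 + (+ 2 - K) * + 1 ≡ + 2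
    a₀≡2 = solve-∀

  n≡p^l⇒SelfReciprocal : ∀ l → SelfReciprocalMod p (coeff (p ^ l) 0)
  n≡p^l⇒SelfReciprocal l = constant-SelfReciprocalMod
    (λ a₀≡0 → 2≢0-mod (subst (_≡ 0ℤ mod p) (coeff-k≡0 (p ^ l) 0) a₀≡0))
    (λ i 0<i → subst (_≡ 0ℤ mod p) (sym (coeff-k≡0 (p ^ l) i))
                 (*-≡0-mod (+ 2) ([p^l]Cj≡0 l (ℕₚ.*-monoʳ-< 2 0<i) (2i≢p^l i))))
    where
    2i≢p^l : ∀ i → 2 ℕ.* i ≢ p ^ l
    2i≢p^l i 2i≡p^l with p^l-odd l
    ... | h , p^l≡1+2h = ℕₚ.even≢odd i h (trans 2i≡p^l p^l≡1+2h)

  n≡3∧k≡3⇒SelfReciprocal : SelfReciprocalMod p (coeff 3 3)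
  n≡3∧k≡3⇒SelfReciprocal = constant-SelfReciprocalMod
    (≢0-mod-product p-prime 2≢0-mod 4≢0-mod)
    (λ { 1 _ → mod-refl ; (suc (suc i)) _ → mod-reflexive (coeff-vanish 1 3 {suc (suc i)} (s≤s (s≤s z≤n))) })

  k≡1⇒SelfReciprocal : ∀ m → ¬ coeff (suc (2 ℕ.* m)) 1 m ≡ 0ℤ mod p → SelfReciprocalMod p (coeff (suc (2 ℕ.* m)) 1)
  k≡1⇒SelfReciprocal m top≢0 = record
    { degree    = m
    ; leading≢0 = top≢0
    ; vanishes  = λ i m<i → mod-reflexive (coeff-vanish m 1 m<i)
    ; symmetric = λ i i≤m → i-j≡0⇒i≡j-mod (mod-reflexive
        (trans (coeff-difference m 1 i (m ∸ i) (ℕₚ.m+[n∸m]≡n i≤m)) (*-zeroˡ (n Cℤ suc (2 ℕ.* i) - n Cℤ (2 ℕ.* i)))))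
    }
    where
    n : ℕ
    n = suc (2 ℕ.* m)

  Classified : ℕ → ℕ → Set
  Classified n k = (n ≡ 1)
                 ⊎ ((k ≡ 0) × IsPowerOfP n)
                 ⊎ ((n ≡ 3) × (k ≡ 3) × 3 < p)
                 ⊎ ((k ≡ 1) × (∀ l → 1 ≤ l → n ℕ.+ 1 ≢ 2 ℕ.* l ℕ.* p))

  classification : ∀ m k → k < p → SelfReciprocalMod p (coeff (suc (2 ℕ.* m)) k) ⇔ Classified (suc (2 ℕ.* m)) k
  classification m k k<p = mk⇔ forward backward
    where
    n : ℕ
    n = suc (2 ℕ.* m)
    no-2lp : ¬ coeff n 1 m ≡ 0ℤ mod p → ∀ l → 1 ≤ l → n ℕ.+ 1 ≢ 2 ℕ.* l ℕ.* p
    no-2lp top≢0 l 1≤l n+1≡2lp =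
      top≢0 (subst (_≡ 0ℤ mod p) (sym (top[k≡1]≡n+1 m))
                   (∣⇒≡0-mod (Equivalence.from (p∣n+1⇔n+1≡2lp m) (l , 1≤l , n+1≡2lp))))
    forward : SelfReciprocalMod p (coeff n k) → Classified n k
    forward sr with ≡0-mod? p (coeff n k m)
    ... | no top≢0 with top≢0⇒k≡1⊎m≡0 m k k<p top≢0 sr
    ...   | inj₁ refl = inj₂ (inj₂ (inj₂ (refl , no-2lp top≢0)))
    ...   | inj₂ refl = inj₁ refl
    forward sr | yes top≡0 with ≡0-mod? p (+ n)
    ...   | yes n≡0 = inj₂ (inj₁ (k≡0 , p∣n⇒n≡p^l m n≡0 (subst (λ k → SelfReciprocalMod p (coeff n k)) k≡0 sr)))
      where
      k≡0 : k ≡ 0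
      k≡0 = p∣n⇒k≡0 m k k<p n≡0 top≡0
    ...   | no n≢0 = inj₂ (inj₂ (inj₁ (p∤n∧top≡0⇒n≡3∧k≡3 m k k<p n≢0 top≡0 sr)))
    backward : Classified n k → SelfReciprocalMod p (coeff n k)
    backward (inj₁ n≡1) = subst (λ n → SelfReciprocalMod p (coeff n k)) (sym n≡1) (n≡1⇒SelfReciprocal k)
    backward (inj₂ (inj₁ (refl , l , _ , n≡p^l))) =
      subst (λ n → SelfReciprocalMod p (coeff n 0)) (sym n≡p^l) (n≡p^l⇒SelfReciprocal l)
    backward (inj₂ (inj₂ (inj₁ (n≡3 , refl , _)))) =
      subst (λ n → SelfReciprocalMod p (coeff n 3)) (sym n≡3) n≡3∧k≡3⇒SelfReciprocal
    backward (inj₂ (inj₂ (inj₂ (refl , n+1≢2lp)))) = k≡1⇒SelfReciprocal m λ top≡0 →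
      let l , 1≤l , n+1≡2lp = Equivalence.to (p∣n+1⇔n+1≡2lp m)
                                (≡0-mod⇒∣ (subst (_≡ 0ℤ mod p) (top[k≡1]≡n+1 m) top≡0))
      in n+1≢2lp l 1≤l n+1≡2lp

open import Data.Nat using (_+_; _*_)
open import Data.Nat.DivMod using (_/_; m≡m%n+[m/n]*n)
open import Function.Properties.Equivalence using () renaming (trans to ⇔-trans)

SelfReciprocal-fCoeff⇔SelfReciprocalMod-coeff : ∀ {p} (pp : Prime p) n k →
  SelfReciprocal (fCoeff p pp (suc n) k) ⇔ SelfReciprocalMod p (coeff (suc n) k)
SelfReciprocal-fCoeff⇔SelfReciprocalMod-coeff pp n k = ⇔-trans
  (SelfReciprocal⇔SelfReciprocalMod {{prime⇒nonZero pp}} (fCoeffℤ (suc n) k))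
  (mk⇔ (SelfReciprocalMod-resp (λ i → mod-reflexive (fCoeffℤ≡coeff n k i)))
        (SelfReciprocalMod-resp (λ i → mod-reflexive (sym (fCoeffℤ≡coeff n k i)))))

theorem3p4 : (p : ℕ) (pp : Prime p) → p % 2 ≡ 1 →
    (k : ℕ) → k ≤ p ∸ 1 →
    (n : ℕ) → 0 < n → n % 2 ≡ 1 →
    SelfReciprocal (fCoeff p pp n k)
      ⇔ ((n ≡ 1)
        ⊎ ((k ≡ 0) × (∃ λ l → 1 ≤ l × n ≡ p ^ l))
        ⊎ ((n ≡ 3) × (k ≡ 3) × 3 < p)
        ⊎ ((k ≡ 1) × (∀ l → 1 ≤ l → n + 1 ≢ 2 * l * p)))
theorem3p4 p pp p-odd k k≤p-1 n _ n-odd =  -- 0 < n already follows from n % 2 ≡ 1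
  subst (λ n → SelfReciprocal (fCoeff p pp n k) ⇔ Classification.Classified pp p-odd n k) (sym n≡1+2m)
    (⇔-trans (SelfReciprocal-fCoeff⇔SelfReciprocalMod-coeff pp (2 * m) k)
             (Classification.classification pp p-odd m k k<p))
  where
  m : ℕ
  m = n / 2
  n≡1+2m : n ≡ suc (2 * m)
  n≡1+2m = trans (m≡m%n+[m/n]*n n 2) (cong₂ _+_ n-odd (ℕₚ.*-comm m 2))
  k<p : k < p
  k<p = ℕₚ.m≤pred[n]⇒suc[m]≤n {{prime⇒nonZero pp}} k≤p-1
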